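{- Let $G=G(V,E)$ be a simple graph with $|V|=n$ (identify $V$ with $[n]$). The Cover-Reversal random walk on the acyclic orientations of $G$ is a simple random walk, of period $2$, on the $1$-skeleton of the polytope $P_G$ (hence on a simple connected bipartite graph whose vertex set is the set of acyclic orientations of $G$), and its stationary distribution $\pi^{\mathrm{CR}}$ satisfies $\pi^{\mathrm{CR}}_O=c\cdot|\mathrm{Cov}(O)|$ for every acyclic orientation $O$ of $G$, where $c>0$ is a normalization constant independent of $O$.
   Context: An acyclic orientation $O$ of $G$ orients every edge with no directed cycles and is viewed as the poset $(V,\le_O)$ it generates, $(u,v)$ meaning $u<_O v$. $\mathrm{Cov}(O)$ is the set of directed edges of $O$ that are cover relations of $(V,\le_O)$. Cover-Reversal random walk: start from any acyclic orientation $O_0$; for $t\ge1$ choose $(u,v)\in\mathrm{Cov}(O_{t-1})$ uniformly at random and let $O_t$ be $O_{t-1}$ with the orientation of $\{u,v\}$ reversed to $(v,u)$. $P_G=\{x\in\mathbb{R}^{[n]}:\sum_i x_i=n+|E|,\ \sum_{i\in\sigma}x_i\ge|\sigma|+|E(G[\sigma])|\ \forall\sigma\subseteq[n]\}$; its vertices are exactly the points $(\mathrm{indeg}_O(i)+1)_{i\in[n]}$ for acyclic orientations $O$ of $G$ ($\mathrm{indeg}_O(i)$ = number of edges directed into $i$), giving the identification of vertices with acyclic orientations. A simple random walk on a graph moves at each step to a uniformly random neighbor.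
   Formalization: The linear functionals defining edges of the 1-skeleton of $P_G$ have rational coefficients, and the stationary distributions, including those covered by the uniqueness claim, take values in ℚ. -}

module Defs where

open import Data.Bool using (Bool; true; false; not; if_then_else_)
open import Data.Nat as ℕ using (ℕ; zero; suc)
open import Data.Nat.Divisibility using (_∣_)
open import Data.Fin using (Fin)
open import Data.Fin.Properties using () renaming (_≟_ to _≟ᶠ_)
open import Data.Bool.Properties using () renaming (_≟_ to _≟ᵇ_)
open import Data.Vec using (Vec; lookup; _[_]%=_; _[_]≔_; allFin)
open import Data.Vec.Properties using (≡-dec)
open import Data.List using (List; length; filter; map; foldr)
open import Data.List.Membership.Propositional using (_∈_)
open import Data.List.Relation.Unary.Unique.Propositional using (Unique)
open import Data.Product using (Σ; Σ-syntax; _×_; _,_; proj₁; proj₂)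
open import Data.Integer using (+_)
open import Data.Rational as ℚ using (ℚ; 0ℚ; 1ℚ; _/_)
open import Relation.Binary.PropositionalEquality using (_≡_; _≢_)
open import Relation.Binary.Construct.Closure.Transitive using (TransClosure)
open import Relation.Binary.Construct.Closure.ReflexiveTransitive using (Star)
open import Relation.Nullary using (¬_; Dec)
open import Function.Bundles using (_⇔_)

record Graph (n : ℕ) : Set where
  field
    adj    : Fin n → Fin n → Bool
    sym    : ∀ u v → adj u v ≡ adj v u
    irrefl : ∀ u → adj u u ≡ false
open Graph public

HasEdge : ∀ {n} → Graph n → Set
HasEdge {n} G = Σ[ u ∈ Fin n ] Σ[ v ∈ Fin n ] adj G u v ≡ true

-- Orientations: an n×n Boolean matrix; entry (u,v) true means the
-- directed edge (u,v), i.e. u <_O v.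

Ori : ℕ → Set
Ori n = Vec (Vec Bool n) n

arc : ∀ {n} → Ori n → Fin n → Fin n → Bool
arc O u v = lookup (lookup O u) v

Arc : ∀ {n} → Ori n → Fin n → Fin n → Set
Arc O u v = arc O u v ≡ true

IsOrientation : ∀ {n} → Graph n → Ori n → Set
IsOrientation {n} G O =
  ∀ (u v : Fin n) → if adj G u v then arc O u v ≡ not (arc O v u)
                                  else arc O u v ≡ false

Lt : ∀ {n} → Ori n → Fin n → Fin n → Set
Lt O = TransClosure (Arc O)

Acyclic : ∀ {n} → Graph n → Ori n → Set
Acyclic {n} G O = IsOrientation G O × (∀ (u : Fin n) → ¬ Lt O u u)

Cover : ∀ {n} → Ori n → Fin n × Fin n → Set
Cover {n} O (u , v) = Arc O u v × ¬ (Σ[ w ∈ Fin n ] (Lt O u w × Lt O w v))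

rev : ∀ {n} → Ori n → Fin n × Fin n → Ori n
rev O (u , v) = (O [ u ]%= (λ row → row [ v ]≔ false)) [ v ]%= (λ row → row [ u ]≔ true)

-- The polytope P_G through its vertices x(O) = (indeg_O(i)+1)_i and its
-- 1-skeleton: O, O' adjacent iff they are distinct and some linear
-- functional attains its maximum over the vertices exactly at {x(O), x(O')}.

boolℕ : Bool → ℕ
boolℕ true  = 1
boolℕ false = 0

sumℕ : ∀ {m} → Vec ℕ m → ℕ
sumℕ = Data.Vec.foldr _ ℕ._+_ 0

indeg : ∀ {n} → Ori n → Fin n → ℕ
indeg O i = sumℕ (Data.Vec.map (λ j → boolℕ (arc O j i)) (allFin _))

point : ∀ {n} → Ori n → Fin n → ℕ
point O i = suc (indeg O i)

dot : ∀ {n} → (Fin n → ℚ) → (Fin n → ℕ) → ℚ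
dot {n} c x = Data.Vec.foldr _ ℚ._+_ 0ℚ
  (Data.Vec.map (λ i → c i ℚ.* (+ x i / 1)) (allFin n))

SkelAdj : ∀ {n} → Graph n → Ori n → Ori n → Set
SkelAdj {n} G O O' =
  O ≢ O' ×
  Σ[ c ∈ (Fin n → ℚ) ]
    (dot c (point O) ≡ dot c (point O') ×
     (∀ W → Acyclic G W → W ≢ O → W ≢ O' → dot c (point W) ℚ.< dot c (point O)))

-- one step of positive probability of the Cover-Reversal walk
CRStep : ∀ {n} → Ori n → Ori n → Set
CRStep {n} O O' = Σ[ e ∈ Fin n × Fin n ] (Cover O e × rev O e ≡ O')

data Walk {n : ℕ} : ℕ → Ori n → Ori n → Set where
  here : ∀ {O} → Walk 0 O O
  step : ∀ {t O O' O''} → CRStep O O' → Walk t O' O'' → Walk (suc t) O O''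

-- d is the period of O: d = gcd { t ≥ 1 : P^t(O,O) > 0 }
IsPeriod : ∀ {n} → Ori n → ℕ → Set
IsPeriod O d =
  (∀ t → Walk t O O → d ∣ t) ×
  (∀ d' → (∀ t → Walk t O O → d' ∣ t) → d' ∣ d)

-- The CR walk from O is the simple random walk on the 1-skeleton:
-- reversal e ↦ rev O e is a bijection from Cov(O) onto the skeleton
-- neighbours of O (so both transition kernels coincide).
CRisSRW : ∀ {n} → Graph n → Set
CRisSRW {n} G = ∀ O → Acyclic G O →
  (∀ e → Cover O e → Acyclic G (rev O e) × SkelAdj G O (rev O e)) ×
  (∀ e e' → Cover O e → Cover O e' → rev O e ≡ rev O e' → e ≡ e') ×
  (∀ O' → Acyclic G O' → SkelAdj G O O' → Σ[ e ∈ Fin n × Fin n ] (Cover O e × rev O e ≡ O'))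

SkelSimple : ∀ {n} → Graph n → Set
SkelSimple G = (∀ O → ¬ SkelAdj G O O) × (∀ O O' → SkelAdj G O O' → SkelAdj G O' O)

SkelEdge : ∀ {n} → Graph n → Ori n → Ori n → Set
SkelEdge G O O' = Acyclic G O × Acyclic G O' × SkelAdj G O O'

SkelConnected : ∀ {n} → Graph n → Set
SkelConnected G = ∀ O O' → Acyclic G O → Acyclic G O' → Star (SkelEdge G) O O'

SkelBipartite : ∀ {n} → Graph n → Set
SkelBipartite {n} G = Σ[ col ∈ (Ori n → Bool) ]
  (∀ O O' → SkelEdge G O O' → col O ≢ col O')

-- Stationary distributions.  AO enumerates the acyclic orientations,
-- cov O enumerates Cov(O).

sumℚ : List ℚ → ℚ
sumℚ = foldr ℚ._+_ 0ℚ

-- k / d as a rational, with the convention 0 when d = 0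
frac : ℕ → ℕ → ℚ
frac k zero    = 0ℚ
frac k (suc d) = + k / suc d

-- P^{CR}(O,O') = #{e ∈ Cov(O) : rev O e = O'} / |Cov(O)|
transP : ∀ {n} → (Ori n → List (Fin n × Fin n)) → Ori n → Ori n → ℚ
transP cov O O' =
  frac (length (filter (λ e → ≡-dec (≡-dec _≟ᵇ_) (rev O e) O') (cov O))) (length (cov O))

IsStationary : ∀ {n} → List (Ori n) → (Ori n → List (Fin n × Fin n)) → (Ori n → ℚ) → Set
IsStationary AO cov π =
  (∀ O → O ∈ AO → 0ℚ ℚ.≤ π O) ×
  sumℚ (map π AO) ≡ 1ℚ ×
  (∀ O' → O' ∈ AO → π O' ≡ sumℚ (map (λ O → π O ℚ.* transP cov O O') AO))

covSize : ∀ {n} → (Ori n → List (Fin n × Fin n)) → Ori n → ℚ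
covSize cov O = + length (cov O) / 1

StationaryCR : ∀ {n} → List (Ori n) → (Ori n → List (Fin n × Fin n)) → Set
StationaryCR {n} AO cov = Σ[ c ∈ ℚ ]
  (0ℚ ℚ.< c ×
   IsStationary AO cov (λ O → c ℚ.* covSize cov O) ×
   (∀ π → IsStationary AO cov π → ∀ O → O ∈ AO → π O ≡ c ℚ.* covSize cov O))

{-# OPTIONS --safe #-}
-- Reversing a cover (u , v) of an acyclic orientation O gives an acyclic orientation O′ in
-- which (v , u) is a cover.  A positive combination of the number of elements below a vertex
-- in O and in O′ is a weight c with c u = c v that increases along every other arc of O; the
-- linear functional ⟨c , x⟩ is then maximised over the vertices of P_G exactly at x(O) and
-- x(O′), so cover reversals are edges of the 1-skeleton.  Conversely, the two ends of an edge
-- maximise some ⟨c , x⟩, so neither orients an edge of G towards smaller c; a cover of O that is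
-- reversed in O′ (one exists whenever O ≠ O′) has equal weights at its ends, and reversing it
-- keeps ⟨c , x⟩ maximal, which forces the reversal to be O′.  A reversal flips the parity of the
-- number of arcs i → j with i < j (bipartite, period 2) and brings O closer to any target
-- (connected).  Being a simple random walk, the walk has π ∝ |Cov| as a stationary
-- distribution, and the maximum principle for π / |Cov| on the connected skeleton shows that
-- it is the only one.
module Submission where

open import Defs hiding (sym)
import Algebra.Properties.CommutativeMonoid.Sum as CommutativeMonoidSum
import Algebra.Properties.Semiring.Sum as SemiringSum
open import Algebra.Bundles using (CommutativeRing)
open import Data.Bool using (Bool; true; false; not; _∧_; _xor_; if_then_else_)
import Data.Bool.Properties as BoolP
open import Data.Empty using (⊥; ⊥-elim)
open import Data.Fin as Fin using (Fin; zero; suc)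
import Data.Fin.Properties as FinP
open import Data.Fin.Induction using (spo-wellFounded)
open import Data.Integer as ℤ using (+_)
import Data.Integer.Properties as ℤP
open import Data.List as List using (List; []; _∷_; length; filter)
import Data.List.Properties as ListP
open import Data.List.Membership.Propositional using (_∈_; find; lose)
open import Data.List.Membership.Propositional.Properties using (∈-length)
import Data.List.Relation.Unary.All as All
open import Data.List.Relation.Unary.AllPairs using (_∷_)
import Data.List.Relation.Unary.Any as Any
open import Data.List.Relation.Unary.Any using (here; there)
open import Data.List.Relation.Unary.Unique.Propositional using (Unique)
open import Data.Nat as ℕ using (ℕ; zero; suc; z≤n; s≤s)
import Data.Nat.Properties as ℕP
import Data.Nat.Coprimality as Coprimality
open import Data.Nat.Divisibility using (_∣_; _∣0; ∣-refl; ∣m∣n⇒∣m+n)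
open import Data.Nat.Induction using (<-wellFounded)
open import Data.Nat.Solver using (module +-*-Solver)
open import Data.Product using (∃; _×_; _,_; proj₁; proj₂; swap)
import Data.Product.Properties as ProductP
open import Data.Product.Relation.Binary.Lex.Strict using (×-Lex; ×-isStrictTotalOrder)
open import Data.Rational as ℚ using (ℚ; 0ℚ; 1ℚ; _/_; toℚᵘ)
import Data.Rational.Properties as ℚP
open import Data.Rational.Solver renaming (module +-*-Solver to ℚ-Solver)
open import Data.Rational.Unnormalised as ℚᵘ using (mkℚᵘ; *≡*; *<*; *≤*)
import Data.Rational.Unnormalised.Properties as ℚᵘP
open import Data.Sum using (_⊎_; inj₁; inj₂)
open import Data.Vec as Vec using (Vec; lookup; tabulate)
import Data.Vec.Functional as Vector
import Data.Vec.Properties as VecP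
open import Function using (_∘_; id)
open import Function.Bundles using (_⇔_; Equivalence)
open import Induction.WellFounded using (WellFounded; Acc; acc)
open import Level using (0ℓ)
open import Relation.Binary using (Rel; Reflexive; Monotonic₂; IsStrictTotalOrder; Tri; tri<; tri≈; tri>)
open import Relation.Binary.Construct.Closure.ReflexiveTransitive using (Star; ε; _◅_; _◅◅_)
open import Relation.Binary.Construct.Closure.Transitive using (TransClosure; [_]; _∷_; _∷ʳ_; _++_; transitive⁻)
open import Relation.Binary.PropositionalEquality
open import Relation.Nullary using (¬_; Dec; yes; no; does; contradiction)
open import Relation.Nullary.Decidable using (_×-dec_; map′; dec-true; dec-false; decidable-stable)

x+x≤y+y⇒x≤y : ∀ {x y} → x ℚ.+ x ℚ.≤ y ℚ.+ y → x ℚ.≤ y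
x+x≤y+y⇒x≤y 2x≤2y = ℚP.≮⇒≥ λ y<x → ℚP.<-irrefl refl (ℚP.<-≤-trans (ℚP.+-mono-< y<x y<x) 2x≤2y)

x+x<y+y⇒x<y : ∀ {x y} → x ℚ.+ x ℚ.< y ℚ.+ y → x ℚ.< y
x+x<y+y⇒x<y 2x<2y = ℚP.≰⇒> λ y≤x → ℚP.<-irrefl refl (ℚP.<-≤-trans 2x<2y (ℚP.+-mono-≤ y≤x y≤x))

ι : ℕ → ℚ
ι k = + k / 1

private
  toℚᵘ-ι : ∀ k → toℚᵘ (ι k) ≡ mkℚᵘ (+ k) 0
  toℚᵘ-ι k = cong toℚᵘ (ℚP.normalize-coprime (Coprimality.sym (Coprimality.1-coprimeTo k)))

  ι-+-cross : ∀ a b → + (a ℕ.+ b) ℤ.* + 1 ≡ (+ a ℤ.* + 1 ℤ.+ + b ℤ.* + 1) ℤ.* + 1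
  ι-+-cross a b = begin
    + (a ℕ.+ b) ℤ.* + 1                    ≡⟨ ℤP.*-identityʳ _ ⟩
    + (a ℕ.+ b)                            ≡⟨ ℤP.pos-+ a b ⟩
    + a ℤ.+ + b                            ≡⟨ cong₂ ℤ._+_ (ℤP.*-identityʳ (+ a)) (ℤP.*-identityʳ (+ b)) ⟨
    + a ℤ.* + 1 ℤ.+ + b ℤ.* + 1            ≡⟨ ℤP.*-identityʳ _ ⟨
    (+ a ℤ.* + 1 ℤ.+ + b ℤ.* + 1) ℤ.* + 1  ∎
    where open ≡-Reasoning

ι-+ : ∀ a b → ι (a ℕ.+ b) ≡ ι a ℚ.+ ι b
ι-+ a b = ℚP.toℚᵘ-injective (begin
  toℚᵘ (ι (a ℕ.+ b))               ≡⟨ toℚᵘ-ι (a ℕ.+ b) ⟩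
  mkℚᵘ (+ (a ℕ.+ b)) 0             ≈⟨ *≡* (ι-+-cross a b) ⟩
  mkℚᵘ (+ a) 0 ℚᵘ.+ mkℚᵘ (+ b) 0   ≡⟨ cong₂ ℚᵘ._+_ (toℚᵘ-ι a) (toℚᵘ-ι b) ⟨
  toℚᵘ (ι a) ℚᵘ.+ toℚᵘ (ι b)       ≈⟨ ℚP.toℚᵘ-homo-+ (ι a) (ι b) ⟨
  toℚᵘ (ι a ℚ.+ ι b)               ∎)
  where open import Relation.Binary.Reasoning.Setoid ℚᵘP.≃-setoid

ι-mono-< : ∀ {a b} → a ℕ.< b → ι a ℚ.< ι b
ι-mono-< {a} {b} a<b = ℚP.toℚᵘ-cancel-< (subst₂ ℚᵘ._<_ (sym (toℚᵘ-ι a)) (sym (toℚᵘ-ι b))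
  (*<* (subst₂ ℤ._<_ (sym (ℤP.*-identityʳ (+ a))) (sym (ℤP.*-identityʳ (+ b))) (ℤ.+<+ a<b))))

ι-mono-≤ : ∀ {a b} → a ℕ.≤ b → ι a ℚ.≤ ι b
ι-mono-≤ {a} {b} a≤b = ℚP.toℚᵘ-cancel-≤ (subst₂ ℚᵘ._≤_ (sym (toℚᵘ-ι a)) (sym (toℚᵘ-ι b))
  (*≤* (subst₂ ℤ._≤_ (sym (ℤP.*-identityʳ (+ a))) (sym (ℤP.*-identityʳ (+ b))) (ℤ.+≤+ a≤b))))

ι-*-frac : ∀ {k m} → k ℕ.≤ m → ι m ℚ.* frac k m ≡ ι k
ι-*-frac {m = zero} z≤n = ℚP.*-zeroʳ (ι 0)
ι-*-frac {k} {suc d} _ = ℚP.toℚᵘ-injective (begin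
  toℚᵘ (ι (suc d) ℚ.* (+ k / suc d))                  ≈⟨ ℚP.toℚᵘ-homo-* (ι (suc d)) (+ k / suc d) ⟩
  toℚᵘ (ι (suc d)) ℚᵘ.* toℚᵘ (+ k / suc d)            ≈⟨ ℚᵘP.*-cong (ℚᵘP.≃-reflexive (toℚᵘ-ι (suc d))) (ℚP.toℚᵘ-fromℚᵘ (mkℚᵘ (+ k) d)) ⟩
  mkℚᵘ (+ suc d) 0 ℚᵘ.* mkℚᵘ (+ k) d                  ≈⟨ *≡* cross ⟩
  mkℚᵘ (+ k) 0                                        ≡⟨ toℚᵘ-ι k ⟨
  toℚᵘ (ι k)                                          ∎)
  where
  open import Relation.Binary.Reasoning.Setoid ℚᵘP.≃-setoid
  cross : (+ suc d ℤ.* + k) ℤ.* + 1 ≡ + k ℤ.* + (1 ℕ.* suc d)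
  cross = trans (ℤP.*-identityʳ _) (trans (ℤP.*-comm (+ suc d) (+ k)) (cong (λ m → + k ℤ.* + m) (sym (ℕP.*-identityˡ (suc d)))))

module MonotoneSum {A : Set} (_+_ : A → A → A) (0# : A) (_≤_ _<_ : Rel A 0ℓ)
  (≤-refl : Reflexive _≤_)
  (+-mono-≤ : Monotonic₂ _≤_ _≤_ _≤_ _+_)
  (+-mono-<-≤ : Monotonic₂ _<_ _≤_ _<_ _+_)
  (+-mono-≤-< : Monotonic₂ _≤_ _<_ _<_ _+_) where

  private
    sum : ∀ {m} → (Fin m → A) → A
    sum = Vector.foldr _+_ 0#

  sum-mono-≤ : ∀ {m} {f g : Fin m → A} → (∀ i → f i ≤ g i) → sum f ≤ sum g
  sum-mono-≤ {zero}  f≤g = ≤-refl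
  sum-mono-≤ {suc m} f≤g = +-mono-≤ (f≤g zero) (sum-mono-≤ (f≤g ∘ suc))

  sum-mono-< : ∀ {m} {f g : Fin m → A} → (∀ i → f i ≤ g i) → ∀ k → f k < g k → sum f < sum g
  sum-mono-< f≤g zero    fk<gk = +-mono-<-≤ fk<gk (sum-mono-≤ (f≤g ∘ suc))
  sum-mono-< f≤g (suc k) fk<gk = +-mono-≤-< (f≤g zero) (sum-mono-< (f≤g ∘ suc) k fk<gk)

module ℕΣ where
  open CommutativeMonoidSum ℕP.+-0-commutativeMonoid public
  open MonotoneSum ℕ._+_ 0 ℕ._≤_ ℕ._<_ ℕP.≤-refl ℕP.+-mono-≤ ℕP.+-mono-<-≤ ℕP.+-mono-≤-< public

module ℚΣ where
  open CommutativeMonoidSum ℚP.+-0-commutativeMonoid public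
  open SemiringSum (CommutativeRing.semiring ℚP.+-*-commutativeRing) public using (*-distribˡ-sum)
  open MonotoneSum ℚ._+_ 0ℚ ℚ._≤_ ℚ._<_ ℚP.≤-refl ℚP.+-mono-≤ ℚP.+-mono-<-≤ ℚP.+-mono-≤-< public

ι-sum : ∀ {m} (f : Fin m → ℕ) → ι (ℕΣ.sum f) ≡ ℚΣ.sum (ι ∘ f)
ι-sum {zero}  f = refl
ι-sum {suc m} f = trans (ι-+ (f zero) _) (cong (ι (f zero) ℚ.+_) (ι-sum (f ∘ suc)))

module ⊕Σ where
  open CommutativeMonoidSum (CommutativeRing.+-commutativeMonoid BoolP.xor-∧-commutativeRing) public

  sum-flip : ∀ {m} {f g : Fin m → Bool} p → (∀ i → i ≢ p → f i ≡ g i) → g p ≡ not (f p) → sum g ≡ not (sum f)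
  sum-flip {suc m} {f} {g} zero f≡g gp = begin
    g zero xor sum (g ∘ suc)        ≡⟨ cong₂ _xor_ gp (sum-cong-≗ (λ i → sym (f≡g (suc i) λ ()))) ⟩
    not (f zero) xor sum (f ∘ suc)  ≡⟨ BoolP.not-distribˡ-xor (f zero) _ ⟨
    not (sum f)                     ∎
    where open ≡-Reasoning
  sum-flip {suc m} {f} {g} (suc p) f≡g gp = begin
    g zero xor sum (g ∘ suc)        ≡⟨ cong₂ _xor_ (sym (f≡g zero λ ())) (sum-flip p f≡g′ gp) ⟩
    f zero xor not (sum (f ∘ suc))  ≡⟨ BoolP.not-distribʳ-xor (f zero) _ ⟨
    not (sum f)                     ∎
    where
    open ≡-Reasoning
    f≡g′ : ∀ i → i ≢ p → f (suc i) ≡ g (suc i)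
    f≡g′ i i≢p = f≡g (suc i) (i≢p ∘ FinP.suc-injective)

  sum²-flip : ∀ {m} {f g : Fin m → Fin m → Bool} p q → (∀ i j → (i , j) ≢ (p , q) → f i j ≡ g i j) → g p q ≡ not (f p q) →
              sum (λ i → sum (g i)) ≡ not (sum (λ i → sum (f i)))
  sum²-flip p q f≡g gpq = sum-flip p (λ i i≢p → sum-cong-≗ (λ j → f≡g i j (i≢p ∘ cong proj₁)))
                                     (sum-flip q (λ j j≢q → f≡g p j (j≢q ∘ cong proj₂)) gpq)

foldr-map-allFin : ∀ {A B : Set} (_⊕_ : A → B → B) (e : B) {m} (f : Fin m → A) →
                   Vec.foldr (λ _ → B) _⊕_ e (Vec.map f (Vec.allFin m)) ≡ Vector.foldr _⊕_ e f
foldr-map-allFin _⊕_ e f = trans (cong (Vec.foldr _ _⊕_ e) (sym (VecP.tabulate-allFin f))) (foldr-tabulate f)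
  where
  foldr-tabulate : ∀ {m} (g : Fin m → _) → Vec.foldr _ _⊕_ e (tabulate g) ≡ Vector.foldr _⊕_ e g
  foldr-tabulate {zero}  g = refl
  foldr-tabulate {suc m} g = cong (g zero ⊕_) (foldr-tabulate (g ∘ suc))

Vec-ext : ∀ {A : Set} {m} {xs ys : Vec A m} → (∀ i → lookup xs i ≡ lookup ys i) → xs ≡ ys
Vec-ext {xs = xs} {ys} eq = trans (sym (VecP.tabulate∘lookup xs)) (trans (VecP.tabulate-cong eq) (VecP.tabulate∘lookup ys))

Ori-ext : ∀ {n} {O O′ : Ori n} → (∀ a b → arc O a b ≡ arc O′ a b) → O ≡ O′
Ori-ext eq = Vec-ext (λ a → Vec-ext (eq a))

Ori-≢⇒arc-≢ : ∀ {n} {O O′ : Ori n} → O ≢ O′ → ∃ λ a → ∃ λ b → arc O a b ≢ arc O′ a b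
Ori-≢⇒arc-≢ {n} {O} {O′} O≢O′ =
  let (a , ¬row) = FinP.¬∀⟶∃¬ n _ (λ a → FinP.all? (λ b → arc O a b BoolP.≟ arc O′ a b)) (O≢O′ ∘ Ori-ext)
      (b , ¬entry) = FinP.¬∀⟶∃¬ n _ (λ b → arc O a b BoolP.≟ arc O′ a b) ¬row
  in a , b , ¬entry

_≟ₒ_ : ∀ {n} (O O′ : Ori n) → Dec (O ≡ O′)
_≟ₒ_ = VecP.≡-dec (VecP.≡-dec BoolP._≟_)

data PairView {n} (u v : Fin n) : Fin n → Fin n → Set where
  at-uv     : PairView u v u v
  at-vu     : PairView u v v u
  elsewhere : ∀ {a b} → (a , b) ≢ (u , v) → (a , b) ≢ (v , u) → PairView u v a b

_≟²_ : ∀ {n} (e e′ : Fin n × Fin n) → Dec (e ≡ e′)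
_≟²_ = ProductP.≡-dec FinP._≟_ FinP._≟_

pairView : ∀ {n} (u v a b : Fin n) → PairView u v a b
pairView u v a b with (a , b) ≟² (u , v) | (a , b) ≟² (v , u)
... | yes refl | _        = at-uv
... | no _     | yes refl = at-vu
... | no ≢uv   | no ≢vu   = elsewhere ≢uv ≢vu

module _ {n} (O : Ori n) {u v : Fin n} (u≢v : u ≢ v) where
  private
    O₁ : Ori n
    O₁ = O Vec.[ u ]%= (λ row → row Vec.[ v ]≔ false)

    row-u : lookup (rev O (u , v)) u ≡ lookup O u Vec.[ v ]≔ false
    row-u = trans (VecP.lookup∘updateAt′ u v u≢v O₁) (VecP.lookup∘updateAt u O)

    row-v : lookup (rev O (u , v)) v ≡ lookup O v Vec.[ u ]≔ true
    row-v = trans (VecP.lookup∘updateAt v O₁) (cong (λ row → row Vec.[ u ]≔ true) (VecP.lookup∘updateAt′ v u (u≢v ∘ sym) O))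

  arc-rev-uv : arc (rev O (u , v)) u v ≡ false
  arc-rev-uv = trans (cong (λ row → lookup row v) row-u) (VecP.lookup∘updateAt v (lookup O u))

  arc-rev-vu : arc (rev O (u , v)) v u ≡ true
  arc-rev-vu = trans (cong (λ row → lookup row u) row-v) (VecP.lookup∘updateAt u (lookup O v))

  arc-rev-elsewhere : ∀ {a b} → (a , b) ≢ (u , v) → (a , b) ≢ (v , u) → arc (rev O (u , v)) a b ≡ arc O a b
  arc-rev-elsewhere {a} {b} ≢uv ≢vu with a FinP.≟ u | a FinP.≟ v
  ... | yes refl | _ = trans (cong (λ row → lookup row b) row-u)
                             (VecP.lookup∘updateAt′ b v (≢uv ∘ cong (a ,_)) (lookup O u))
  ... | no _ | yes refl = trans (cong (λ row → lookup row b) row-v)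
                                (VecP.lookup∘updateAt′ b u (≢vu ∘ cong (a ,_)) (lookup O v))
  ... | no a≢u | no a≢v = cong (λ row → lookup row b)
                            (trans (VecP.lookup∘updateAt′ a v a≢v O₁) (VecP.lookup∘updateAt′ a u a≢u O))

module _ {A : Set} {R : Rel A 0ℓ} where

  TC⇒Star : ∀ {x y} → TransClosure R x y → Star R x y
  TC⇒Star [ r ]    = r ◅ ε
  TC⇒Star (r ∷ rs) = r ◅ TC⇒Star rs

  Star++TC : ∀ {x y z} → Star R x y → TransClosure R y z → TransClosure R x z
  Star++TC ε        t = t
  Star++TC (r ◅ rs) t = r ∷ Star++TC rs t

  TC++Star : ∀ {x y z} → TransClosure R x y → Star R y z → TransClosure R x z
  TC++Star t ε        = t
  TC++Star t (r ◅ rs) = TC++Star (t ∷ʳ r) rs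

  Star⇒≡⊎TC : ∀ {x y} → Star R x y → x ≡ y ⊎ TransClosure R x y
  Star⇒≡⊎TC ε        = inj₁ refl
  Star⇒≡⊎TC (r ◅ rs) = inj₂ (TC++Star [ r ] rs)

  TC-unsnoc : ∀ {x y} → TransClosure R x y → R x y ⊎ ∃ λ z → TransClosure R x z × R z y
  TC-unsnoc [ r ] = inj₁ r
  TC-unsnoc (r ∷ rs) with TC-unsnoc rs
  ... | inj₁ r′            = inj₂ (_ , [ r ] , r′)
  ... | inj₂ (z , rs′ , r′) = inj₂ (z , r ∷ rs′ , r′)

TC-map : ∀ {A : Set} {R S : Rel A 0ℓ} → (∀ {a b} → R a b → S a b) → ∀ {x y} → TransClosure R x y → TransClosure S x y
TC-map f [ r ]    = [ f r ]
TC-map f (r ∷ rs) = f r ∷ TC-map f rs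

module _ {A : Set} {R S : Rel A 0ℓ} {u v : A} (S⊆R∪vu : ∀ {a b} → S a b → (a , b) ≡ (v , u) ⊎ R a b) where

  TC-split : ∀ {x y} → TransClosure S x y → TransClosure R x y ⊎ (Star R x v × Star R u y)
  TC-split [ s ] with S⊆R∪vu s
  ... | inj₁ refl = inj₂ (ε , ε)
  ... | inj₂ r    = inj₁ [ r ]
  TC-split (s ∷ ss) with S⊆R∪vu s | TC-split ss
  ... | inj₁ refl | inj₁ rs          = inj₂ (ε , TC⇒Star rs)
  ... | inj₁ refl | inj₂ (_ , u⇝y)   = inj₂ (ε , u⇝y)
  ... | inj₂ r    | inj₁ rs          = inj₁ (r ∷ rs)
  ... | inj₂ r    | inj₂ (x⇝v , u⇝y) = inj₂ (r ◅ x⇝v , u⇝y)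

interval-shrinkˡ : ∀ {a x y b} → a ℕ.< x → x ℕ.≤ y → y ℕ.≤ b → y ℕ.∸ x ℕ.< b ℕ.∸ a
interval-shrinkˡ {x = x} a<x x≤y y≤b = ℕP.≤-<-trans (ℕP.∸-monoˡ-≤ x y≤b) (ℕP.∸-monoʳ-< a<x (ℕP.≤-trans x≤y y≤b))

interval-shrinkʳ : ∀ {a x y b} → a ℕ.≤ x → x ℕ.≤ y → y ℕ.< b → y ℕ.∸ x ℕ.< b ℕ.∸ a
interval-shrinkʳ {y = y} a≤x x≤y y<b = ℕP.≤-<-trans (ℕP.∸-monoʳ-≤ y a≤x) (ℕP.∸-monoˡ-< y<b (ℕP.≤-trans a≤x x≤y))

indicator-mono-≤ : ∀ {P Q : Set} → (P → Q) → (P? : Dec P) (Q? : Dec Q) → boolℕ (does P?) ℕ.≤ boolℕ (does Q?)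
indicator-mono-≤ P⇒Q (yes p) (yes _) = ℕP.≤-refl
indicator-mono-≤ P⇒Q (yes p) (no ¬q) = contradiction (P⇒Q p) ¬q
indicator-mono-≤ P⇒Q (no _)  _       = z≤n

indicator-mono-< : ∀ {P Q : Set} → ¬ P → Q → (P? : Dec P) (Q? : Dec Q) → boolℕ (does P?) ℕ.< boolℕ (does Q?)
indicator-mono-< ¬p q (yes p) _       = contradiction p ¬p
indicator-mono-< ¬p q (no _)  (yes _) = s≤s z≤n
indicator-mono-< ¬p q (no _)  (no ¬q) = contradiction q ¬q

module StrictOrder {n} (O : Ori n) (acyclic : ∀ u → ¬ Lt O u u) where

  Lt-wellFounded : WellFounded (Lt O)
  Lt-wellFounded = spo-wellFounded record
    { isEquivalence = isEquivalence
    ; irrefl        = λ { refl → acyclic _ }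
    ; trans         = _++_
    ; <-resp-≈      = resp₂ (Lt O)
    }

  Lt? : ∀ x y → Dec (Lt O x y)
  Lt? x y = Lt?-acc (Lt-wellFounded y)
    where
    Lt?-acc : ∀ {y} → Acc (Lt O) y → Dec (Lt O x y)
    Lt?-acc {y} (acc rs) = map′ to from (FinP.any? last-arc?)
      where
      LastArc : Fin n → Set
      LastArc z = Arc O z y × (x ≡ z ⊎ Lt O x z)

      last-arc? : ∀ z → Dec (LastArc z)
      last-arc? z with arc O z y in z→y
      ... | false = no λ { (() , _) }
      ... | true with x FinP.≟ z
      ...   | yes x≡z = yes (refl , inj₁ x≡z)
      ...   | no x≢z with Lt?-acc (rs [ z→y ])
      ...     | yes x<z = yes (refl , inj₂ x<z)
      ...     | no x≮z  = no λ { (_ , inj₁ x≡z) → x≢z x≡z ; (_ , inj₂ x<z) → x≮z x<z }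

      to : ∃ LastArc → Lt O x y
      to (z , z→y , inj₁ refl) = [ z→y ]
      to (z , z→y , inj₂ x<z)  = x<z ∷ʳ z→y

      from : Lt O x y → ∃ LastArc
      from x<y with TC-unsnoc x<y
      ... | inj₁ x→y             = x , x→y , inj₁ refl
      ... | inj₂ (z , x<z , z→y) = z , z→y , inj₂ x<z

  abstract
    #below : Fin n → ℕ
    #below w = ℕΣ.sum (λ x → boolℕ (does (Lt? x w)))

    #below-mono-< : ∀ {a b} → Lt O a b → #below a ℕ.< #below b
    #below-mono-< {a} {b} a<b =
      ℕΣ.sum-mono-< (λ x → indicator-mono-≤ (_++ a<b) (Lt? x a) (Lt? x b)) a
                    (indicator-mono-< (acyclic a) a<b (Lt? a a) (Lt? a b))

  #below-mono-≤ : ∀ {a b} → Star (Arc O) a b → #below a ℕ.≤ #below b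
  #below-mono-≤ a≤b with Star⇒≡⊎TC a≤b
  ... | inj₁ refl = ℕP.≤-refl
  ... | inj₂ a<b  = ℕP.<⇒≤ (#below-mono-< a<b)

sumL : ∀ {A : Set} → (A → ℚ) → List A → ℚ
sumL f xs = sumℚ (List.map f xs)

count : ∀ {A : Set} {P : A → Set} → (∀ x → Dec (P x)) → List A → ℕ
count P? xs = length (filter P? xs)

module _ {A : Set} where

  sumL-cong : ∀ {f g : A → ℚ} xs → (∀ {x} → x ∈ xs → f x ≡ g x) → sumL f xs ≡ sumL g xs
  sumL-cong []       f≡g = refl
  sumL-cong (x ∷ xs) f≡g = cong₂ ℚ._+_ (f≡g (here refl)) (sumL-cong xs (f≡g ∘ there))

  sumL-+ : ∀ (f g : A → ℚ) xs → sumL (λ x → f x ℚ.+ g x) xs ≡ sumL f xs ℚ.+ sumL g xs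
  sumL-+ f g []       = sym (ℚP.+-identityʳ 0ℚ)
  sumL-+ f g (x ∷ xs) = begin
    (f x ℚ.+ g x) ℚ.+ sumL (λ x → f x ℚ.+ g x) xs  ≡⟨ cong ((f x ℚ.+ g x) ℚ.+_) (sumL-+ f g xs) ⟩
    (f x ℚ.+ g x) ℚ.+ (sumL f xs ℚ.+ sumL g xs)    ≡⟨ interchange (f x) (g x) (sumL f xs) (sumL g xs) ⟩
    (f x ℚ.+ sumL f xs) ℚ.+ (g x ℚ.+ sumL g xs)    ∎
    where
    open ≡-Reasoning
    open ℚ-Solver
    interchange : ∀ a b c d → (a ℚ.+ b) ℚ.+ (c ℚ.+ d) ≡ (a ℚ.+ c) ℚ.+ (b ℚ.+ d)
    interchange = solve 4 (λ a b c d → (a :+ b) :+ (c :+ d) := (a :+ c) :+ (b :+ d)) refl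

  sumL-*ˡ : ∀ a (f : A → ℚ) xs → sumL (λ x → a ℚ.* f x) xs ≡ a ℚ.* sumL f xs
  sumL-*ˡ a f []       = sym (ℚP.*-zeroʳ a)
  sumL-*ˡ a f (x ∷ xs) = trans (cong (a ℚ.* f x ℚ.+_) (sumL-*ˡ a f xs)) (sym (ℚP.*-distribˡ-+ a (f x) _))

  sumL-const : ∀ a (xs : List A) → sumL (λ _ → a) xs ≡ a ℚ.* ι (length xs)
  sumL-const a []       = sym (ℚP.*-zeroʳ a)
  sumL-const a (x ∷ xs) = begin
    a ℚ.+ sumL (λ _ → a) xs         ≡⟨ cong (a ℚ.+_) (sumL-const a xs) ⟩
    a ℚ.+ a ℚ.* ι (length xs)       ≡⟨ cong (ℚ._+ a ℚ.* ι (length xs)) (ℚP.*-identityʳ a) ⟨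
    a ℚ.* 1ℚ ℚ.+ a ℚ.* ι (length xs) ≡⟨ ℚP.*-distribˡ-+ a 1ℚ _ ⟨
    a ℚ.* (1ℚ ℚ.+ ι (length xs))    ≡⟨ cong (a ℚ.*_) (ι-+ 1 (length xs)) ⟨
    a ℚ.* ι (suc (length xs))       ∎
    where open ≡-Reasoning

  sumL-mono-≤ : ∀ {f g : A → ℚ} xs → (∀ {x} → x ∈ xs → f x ℚ.≤ g x) → sumL f xs ℚ.≤ sumL g xs
  sumL-mono-≤ []       f≤g = ℚP.≤-refl
  sumL-mono-≤ (x ∷ xs) f≤g = ℚP.+-mono-≤ (f≤g (here refl)) (sumL-mono-≤ xs (f≤g ∘ there))

  sumL-≤-≡⇒≡ : ∀ {f g : A → ℚ} xs → (∀ {x} → x ∈ xs → f x ℚ.≤ g x) → sumL f xs ≡ sumL g xs →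
                ∀ {x} → x ∈ xs → f x ≡ g x
  sumL-≤-≡⇒≡ {f} {g} (y ∷ ys) f≤g Σf≡Σg = λ { (here refl) → fy≡gy ; (there x∈ys) → sumL-≤-≡⇒≡ ys (f≤g ∘ there) Σf≡Σg′ x∈ys }
    where
    fy≤gy = f≤g (here refl)
    Σf≤Σg = sumL-mono-≤ ys (f≤g ∘ there)
    fy≡gy : f y ≡ g y
    fy≡gy = ℚP.≤-antisym fy≤gy (ℚP.≮⇒≥ λ fy<gy → ℚP.<-irrefl Σf≡Σg (ℚP.+-mono-<-≤ fy<gy Σf≤Σg))
    Σf≡Σg′ : sumL f ys ≡ sumL g ys
    Σf≡Σg′ = ℚP.≤-antisym Σf≤Σg (ℚP.≮⇒≥ λ Σf<Σg → ℚP.<-irrefl Σf≡Σg (ℚP.+-mono-≤-< fy≤gy Σf<Σg))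

  sumL-zero : ∀ {f : A → ℚ} xs → (∀ {x} → x ∈ xs → f x ≡ 0ℚ) → sumL f xs ≡ 0ℚ
  sumL-zero xs f≡0 = trans (sumL-cong xs f≡0) (trans (sumL-const 0ℚ xs) (ℚP.*-zeroˡ (ι (length xs))))

  argmax : ∀ (f : A → ℚ) {y} xs → y ∈ xs → ∃ λ m → m ∈ xs × (∀ {x} → x ∈ xs → f x ℚ.≤ f m)
  argmax f (x ∷ [])     _ = x , here refl , λ { (here refl) → ℚP.≤-refl }
  argmax f (x ∷ x′ ∷ xs) _ with argmax f (x′ ∷ xs) (here refl)
  ... | m , m∈ , max with f x ℚ.≤? f m
  ...   | yes fx≤fm = m , there m∈ , λ { (here refl) → fx≤fm ; (there x∈) → max x∈ }
  ...   | no fx≰fm  = x , here refl , λ { (here refl) → ℚP.≤-refl ; (there x∈) → ℚP.≤-trans (max x∈) (ℚP.<⇒≤ (ℚP.≰⇒> fx≰fm)) }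

  module _ {P : A → Set} (P? : ∀ x → Dec (P x)) where

    count-∷ : ∀ x xs → count P? (x ∷ xs) ≡ boolℕ (does (P? x)) ℕ.+ count P? xs
    count-∷ x xs with P? x
    ... | yes _ = refl
    ... | no _  = refl

    count-none : ∀ xs → (∀ {x} → x ∈ xs → ¬ P x) → count P? xs ≡ 0
    count-none xs ¬P = cong length (ListP.filter-none P? (All.tabulate ¬P))

    count-unique : ∀ {xs} → Unique xs → (∀ {x y} → x ∈ xs → y ∈ xs → P x → P y → x ≡ y) →
                   ∀ {x} → x ∈ xs → P x → count P? xs ≡ 1
    count-unique {y ∷ ys} (y∉ys ∷ unique) P-unique {x} x∈ Px with P? y
    ... | yes Py = cong suc (count-none ys λ z∈ys Pz → All.lookup y∉ys z∈ys (P-unique (here refl) (there z∈ys) Py Pz))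
    ... | no ¬Py with x∈
    ...   | here refl  = contradiction Px ¬Py
    ...   | there x∈ys = count-unique unique (λ x∈ y∈ → P-unique (there x∈) (there y∈)) x∈ys Px

module _ {A B : Set} (_≟_ : (b b′ : B) → Dec (b ≡ b′)) where

  private
    selected : ∀ (w : B → ℚ) b → w b ℚ.* ι (boolℕ (does (b ≟ b))) ≡ w b
    selected w b = trans (cong (λ t → w b ℚ.* ι (boolℕ t)) (dec-true (b ≟ b) refl)) (ℚP.*-identityʳ (w b))

    unselected : ∀ (w : B → ℚ) {b b′} → b ≢ b′ → w b′ ℚ.* ι (boolℕ (does (b ≟ b′))) ≡ 0ℚ
    unselected w {b} {b′} b≢b′ = trans (cong (λ t → w b′ ℚ.* ι (boolℕ t)) (dec-false (b ≟ b′) b≢b′)) (ℚP.*-zeroʳ (w b′))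

  sumL-select : ∀ (w : B → ℚ) {bs} → Unique bs → ∀ {b} → b ∈ bs →
                sumL (λ b′ → w b′ ℚ.* ι (boolℕ (does (b ≟ b′)))) bs ≡ w b
  sumL-select w {b ∷ bs} (b∉bs ∷ _) (here refl) =
    trans (cong₂ ℚ._+_ (selected w b) (sumL-zero bs (λ b′∈bs → unselected w (All.lookup b∉bs b′∈bs)))) (ℚP.+-identityʳ (w b))
  sumL-select w {b₀ ∷ bs} (b₀∉bs ∷ unique) {b} (there b∈bs) =
    trans (cong₂ ℚ._+_ (unselected w (All.lookup b₀∉bs b∈bs ∘ sym)) (sumL-select w unique b∈bs)) (ℚP.+-identityˡ (w b))

  sumL-fibres : ∀ (w : B → ℚ) (g : A → B) {bs} → Unique bs → ∀ es → (∀ {e} → e ∈ es → g e ∈ bs) →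
                sumL (λ b → w b ℚ.* ι (count (λ e → g e ≟ b) es)) bs ≡ sumL (w ∘ g) es
  sumL-fibres w g {bs} unique [] _ = sumL-zero bs (λ {b} _ → ℚP.*-zeroʳ (w b))
  sumL-fibres w g {bs} unique (e ∷ es) g∈ = begin
    sumL (λ b → w b ℚ.* ι (count (λ e → g e ≟ b) (e ∷ es))) bs
      ≡⟨ sumL-cong bs (λ {b} _ → split b) ⟩
    sumL (λ b → w b ℚ.* ι (boolℕ (does (g e ≟ b))) ℚ.+ w b ℚ.* ι (count (λ e → g e ≟ b) es)) bs
      ≡⟨ sumL-+ _ _ bs ⟩
    sumL (λ b → w b ℚ.* ι (boolℕ (does (g e ≟ b)))) bs ℚ.+ sumL (λ b → w b ℚ.* ι (count (λ e → g e ≟ b) es)) bs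
      ≡⟨ cong₂ ℚ._+_ (sumL-select w unique (g∈ (here refl))) (sumL-fibres w g unique es (g∈ ∘ there)) ⟩
    w (g e) ℚ.+ sumL (w ∘ g) es
      ∎
    where
    open ≡-Reasoning
    split : ∀ b → w b ℚ.* ι (count (λ e → g e ≟ b) (e ∷ es)) ≡
                  w b ℚ.* ι (boolℕ (does (g e ≟ b))) ℚ.+ w b ℚ.* ι (count (λ e → g e ≟ b) es)
    split b = begin
      w b ℚ.* ι (count (λ e → g e ≟ b) (e ∷ es))
        ≡⟨ cong (λ k → w b ℚ.* ι k) (count-∷ (λ e → g e ≟ b) e es) ⟩
      w b ℚ.* ι (boolℕ (does (g e ≟ b)) ℕ.+ count (λ e → g e ≟ b) es)
        ≡⟨ cong (w b ℚ.*_) (ι-+ (boolℕ (does (g e ≟ b))) (count (λ e → g e ≟ b) es)) ⟩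
      w b ℚ.* (ι (boolℕ (does (g e ≟ b))) ℚ.+ ι (count (λ e → g e ≟ b) es))
        ≡⟨ ℚP.*-distribˡ-+ (w b) _ _ ⟩
      w b ℚ.* ι (boolℕ (does (g e ≟ b))) ℚ.+ w b ℚ.* ι (count (λ e → g e ≟ b) es)
        ∎

ArcExcept : ∀ {n} → Ori n → Fin n × Fin n → Fin n → Fin n → Set
ArcExcept O e a b = Arc O a b × (a , b) ≢ e

module _ {n : ℕ} (G : Graph n) where

  isOrientation : ∀ {O : Ori n} → (∀ {a b} → adj G a b ≡ true → arc O a b ≡ not (arc O b a)) →
                  (∀ {a b} → adj G a b ≡ false → arc O a b ≡ false) → IsOrientation G O
  isOrientation edge nonedge a b with adj G a b in e
  ... | true  = edge e
  ... | false = nonedge e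

  adj-sym : ∀ {a b} → adj G a b ≡ true → adj G b a ≡ true
  adj-sym {a} {b} e = trans (Graph.sym G b a) e

  module Oriented (O : Ori n) (o : IsOrientation G O) where

    edge-arc : ∀ {a b} → adj G a b ≡ true → arc O a b ≡ not (arc O b a)
    edge-arc {a} {b} e = subst (λ t → if t then arc O a b ≡ not (arc O b a) else arc O a b ≡ false) e (o a b)

    nonedge-arc : ∀ {a b} → adj G a b ≡ false → arc O a b ≡ false
    nonedge-arc {a} {b} e = subst (λ t → if t then arc O a b ≡ not (arc O b a) else arc O a b ≡ false) e (o a b)

    arc⇒adj : ∀ {a b} → Arc O a b → adj G a b ≡ true
    arc⇒adj {a} {b} a→b with adj G a b in e
    ... | true  = refl
    ... | false = contradiction (trans (sym a→b) (nonedge-arc e)) λ ()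

    arc-asym : ∀ {a b} → Arc O a b → arc O b a ≡ false
    arc-asym a→b = trans (edge-arc (adj-sym (arc⇒adj a→b))) (cong not a→b)

    arc⇒≢ : ∀ {a b} → Arc O a b → a ≢ b
    arc⇒≢ {a} a→b refl = contradiction (trans (sym (arc⇒adj a→b)) (Graph.irrefl G a)) λ ()

    ¬arc⇒arc : ∀ {a b} → adj G a b ≡ true → arc O a b ≡ false → Arc O b a
    ¬arc⇒arc e a↛b = trans (edge-arc (adj-sym e)) (cong not a↛b)

    edge⇒arc⊎arc : ∀ {a b} → adj G a b ≡ true → Arc O a b ⊎ Arc O b a
    edge⇒arc⊎arc {a} {b} e with arc O a b in a→b
    ... | true  = inj₁ refl
    ... | false = inj₂ (¬arc⇒arc e a→b)

  ≢⇒reversed-arc : ∀ {O W} → IsOrientation G O → IsOrientation G W → O ≢ W →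
                   ∃ λ a → ∃ λ b → Arc O a b × Arc W b a
  ≢⇒reversed-arc {O} {W} o w O≢W = reversed (Ori-≢⇒arc-≢ O≢W)
    where
    module O = Oriented O o
    module W = Oriented W w
    reversed : (∃ λ a → ∃ λ b → arc O a b ≢ arc W a b) → ∃ λ a → ∃ λ b → Arc O a b × Arc W b a
    reversed (a , b , ≢ab) with arc O a b in a→b | arc W a b in a→ᵂb
    ... | true  | true  = contradiction refl ≢ab
    ... | false | false = contradiction refl ≢ab
    ... | true  | false = a , b , a→b , W.¬arc⇒arc (O.arc⇒adj a→b) a→ᵂb
    ... | false | true  = b , a , O.¬arc⇒arc (W.arc⇒adj a→ᵂb) a→b , a→ᵂb

  module ArcReversal (O : Ori n) (o : IsOrientation G O) (u v : Fin n) (u→v : Arc O u v) where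
    open Oriented O o

    u≢v : u ≢ v
    u≢v = arc⇒≢ u→v

    rev-isOrientation : IsOrientation G (rev O (u , v))
    rev-isOrientation = isOrientation {rev O (u , v)} edge nonedge
      where
      edge : ∀ {a b} → adj G a b ≡ true → arc (rev O (u , v)) a b ≡ not (arc (rev O (u , v)) b a)
      edge {a} {b} e with pairView u v a b
      ... | at-uv = trans (arc-rev-uv O u≢v) (cong not (sym (arc-rev-vu O u≢v)))
      ... | at-vu = trans (arc-rev-vu O u≢v) (cong not (sym (arc-rev-uv O u≢v)))
      ... | elsewhere ≢uv ≢vu = begin
        arc (rev O (u , v)) a b        ≡⟨ arc-rev-elsewhere O u≢v ≢uv ≢vu ⟩
        arc O a b                      ≡⟨ edge-arc e ⟩
        not (arc O b a)                ≡⟨ cong not (arc-rev-elsewhere O u≢v (≢vu ∘ cong swap) (≢uv ∘ cong swap)) ⟨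
        not (arc (rev O (u , v)) b a)  ∎
        where open ≡-Reasoning
      nonedge : ∀ {a b} → adj G a b ≡ false → arc (rev O (u , v)) a b ≡ false
      nonedge {a} {b} e with pairView u v a b
      ... | at-uv = arc-rev-uv O u≢v
      ... | at-vu = contradiction (trans (sym (adj-sym (arc⇒adj u→v))) e) λ ()
      ... | elsewhere ≢uv ≢vu = trans (arc-rev-elsewhere O u≢v ≢uv ≢vu) (nonedge-arc e)

    arc-rev⇒ : ∀ {a b} → Arc (rev O (u , v)) a b → (a , b) ≡ (v , u) ⊎ ArcExcept O (u , v) a b
    arc-rev⇒ {a} {b} a→b with pairView u v a b
    ... | at-uv = contradiction (trans (sym a→b) (arc-rev-uv O u≢v)) λ ()
    ... | at-vu = inj₁ refl
    ... | elsewhere ≢uv ≢vu = inj₂ (trans (sym (arc-rev-elsewhere O u≢v ≢uv ≢vu)) a→b , ≢uv)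

    ArcExcept⇒arc-rev : ∀ {a b} → ArcExcept O (u , v) a b → Arc (rev O (u , v)) a b
    ArcExcept⇒arc-rev {a} {b} (a→b , ≢uv′) with pairView u v a b
    ... | at-uv = contradiction refl ≢uv′
    ... | at-vu = contradiction (trans (sym a→b) (arc-asym u→v)) λ ()
    ... | elsewhere ≢uv ≢vu = trans (arc-rev-elsewhere O u≢v ≢uv ≢vu) a→b

    rev-≢ : rev O (u , v) ≢ O
    rev-≢ O′≡O = contradiction (trans (sym u→v) (trans (cong (λ X → arc X u v) (sym O′≡O)) (arc-rev-uv O u≢v))) λ ()

    rev-involutive : rev (rev O (u , v)) (v , u) ≡ O
    rev-involutive = Ori-ext entry
      where
      entry : ∀ a b → arc (rev (rev O (u , v)) (v , u)) a b ≡ arc O a b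
      entry a b with pairView v u a b
      ... | at-uv = trans (arc-rev-uv (rev O (u , v)) (u≢v ∘ sym)) (sym (arc-asym u→v))
      ... | at-vu = trans (arc-rev-vu (rev O (u , v)) (u≢v ∘ sym)) (sym u→v)
      ... | elsewhere ≢vu ≢uv = trans (arc-rev-elsewhere (rev O (u , v)) (u≢v ∘ sym) ≢vu ≢uv)
                                      (arc-rev-elsewhere O u≢v ≢uv ≢vu)

    rev-injective : ∀ {u′ v′} → Arc O u′ v′ → rev O (u , v) ≡ rev O (u′ , v′) → (u , v) ≡ (u′ , v′)
    rev-injective {u′} {v′} u′→v′ rev≡rev with pairView u′ v′ u v
    ... | at-uv = refl
    ... | at-vu = contradiction (trans (sym u′→v′) (arc-asym u→v)) λ ()
    ... | elsewhere ≢uv ≢vu = contradiction (begin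
      true                         ≡⟨ u→v ⟨
      arc O u v                    ≡⟨ arc-rev-elsewhere O (Oriented.arc⇒≢ O o u′→v′) ≢uv ≢vu ⟨
      arc (rev O (u′ , v′)) u v    ≡⟨ cong (λ X → arc X u v) rev≡rev ⟨
      arc (rev O (u , v)) u v      ≡⟨ arc-rev-uv O u≢v ⟩
      false                        ∎) λ ()
      where open ≡-Reasoning

  module CoverReversal (O : Ori n) (acO : Acyclic G O) (u v : Fin n) (cover : Cover O (u , v)) where
    open ArcReversal O (proj₁ acO) u v (proj₁ cover)

    private
      M = ArcExcept O (u , v)

      cycle : ∀ {x} → ¬ TransClosure M x x
      cycle = proj₂ acO _ ∘ TC-map proj₁

    no-detour : ¬ Star M u v
    no-detour ε                    = u≢v refl
    no-detour ((_ , ≢uv) ◅ ε)      = ≢uv refl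
    no-detour ((u→w , _) ◅ r ◅ rs) = proj₂ cover (_ , [ u→w ] , TC-map proj₁ (TC++Star [ r ] rs))

    rev-acyclic : ∀ x → ¬ Lt (rev O (u , v)) x x
    rev-acyclic x x<x with TC-split arc-rev⇒ x<x
    ... | inj₁ x<x′         = cycle x<x′
    ... | inj₂ (x⇝v , u⇝x) = no-detour (u⇝x ◅◅ x⇝v)

    rev-Acyclic : Acyclic G (rev O (u , v))
    rev-Acyclic = rev-isOrientation , rev-acyclic

    rev-Cover : Cover (rev O (u , v)) (v , u)
    rev-Cover = arc-rev-vu O u≢v , λ (w , v<w , w<u) → no-interval (TC-split arc-rev⇒ v<w) (TC-split arc-rev⇒ w<u)
      where
      no-interval : ∀ {w} → TransClosure M v w ⊎ (Star M v v × Star M u w) →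
                    TransClosure M w u ⊎ (Star M w v × Star M u u) → ⊥
      no-interval (inj₁ v⇝w)       (inj₁ w⇝u)       = proj₂ acO u (proj₁ cover ∷ TC-map proj₁ (v⇝w ++ w⇝u))
      no-interval (inj₁ v⇝w)       (inj₂ (w⇝v , _)) = cycle (TC++Star v⇝w w⇝v)
      no-interval (inj₂ (_ , u⇝w)) (inj₁ w⇝u)       = cycle (Star++TC u⇝w w⇝u)
      no-interval (inj₂ (_ , u⇝w)) (inj₂ (w⇝v , _)) = no-detour (u⇝w ◅◅ w⇝v)

  module _ {O O′ : Ori n} (acO : Acyclic G O) (acO′ : Acyclic G O′) where
    private
      module O = Oriented O (proj₁ acO)
      module O′ = Oriented O′ (proj₁ acO′)
      open StrictOrder O (proj₂ acO)
      _≤ₒ_ = Star (Arc O)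

    reversed-arc-on-path : ∀ {a b} → Lt O a b → ¬ Lt O′ a b →
                           ∃ λ x → ∃ λ y → a ≤ₒ x × Arc O x y × y ≤ₒ b × Arc O′ y x
    reversed-arc-on-path {a} {b} [ a→b ] a≮′b =
      a , b , ε , a→b , ε , O′.¬arc⇒arc (O.arc⇒adj a→b) (BoolP.¬-not (a≮′b ∘ [_]))
    reversed-arc-on-path {a} (_∷_ {y = y} a→y y<b) a≮′b with arc O′ a y in a→′y
    ... | true  = let (x , y′ , y≤x , x→y′ , y′≤b , y′→′x) = reversed-arc-on-path y<b (a≮′b ∘ (a→′y ∷_))
                  in x , y′ , a→y ◅ y≤x , x→y′ , y′≤b , y′→′x
    ... | false = a , y , ε , a→y , TC⇒Star y<b , O′.¬arc⇒arc (O.arc⇒adj a→y) a→′y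

    private
      span : Fin n → Fin n → ℕ
      span a b = #below b ℕ.∸ #below a

      -- If a → b is no cover, a < w < b for some w; O′ cannot have both a <′ w and w <′ b, so
      -- a path a ⇝ w or w ⇝ b of O contains an arc reversed in O′ with a shorter span.
      shortest-reversed : ∀ {a b} → Acc ℕ._<_ (span a b) → Arc O a b → Arc O′ b a →
                          ∃ λ u → ∃ λ v → Cover O (u , v) × Arc O′ v u
      shortest-reversed {a} {b} (acc smaller) a→b b→′a with FinP.any? (λ w → Lt? a w ×-dec Lt? w b)
      ... | no ∄w = a , b , (a→b , ∄w) , b→′a
      ... | yes (w , a<w , w<b) with StrictOrder.Lt? O′ (proj₂ acO′) a w
      ...   | yes a<′w =
              let (x , y , w≤x , x→y , y≤b , y→′x) = reversed-arc-on-path w<b (λ w<′b → proj₂ acO′ a (a<′w ++ (w<′b ∷ʳ b→′a)))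
              in shortest-reversed (smaller (interval-shrinkˡ (ℕP.<-≤-trans (#below-mono-< a<w) (#below-mono-≤ w≤x))
                                                              (ℕP.<⇒≤ (#below-mono-< [ x→y ])) (#below-mono-≤ y≤b)))
                                   x→y y→′x
      ...   | no a≮′w =
              let (x , y , a≤x , x→y , y≤w , y→′x) = reversed-arc-on-path a<w a≮′w
              in shortest-reversed (smaller (interval-shrinkʳ (#below-mono-≤ a≤x) (ℕP.<⇒≤ (#below-mono-< [ x→y ]))
                                                              (ℕP.≤-<-trans (#below-mono-≤ y≤w) (#below-mono-< w<b))))
                                   x→y y→′x

    cover-reversed : O ≢ O′ → ∃ λ u → ∃ λ v → Cover O (u , v) × Arc O′ v u
    cover-reversed O≢O′ =
      let (a , b , a→b , b→′a) = ≢⇒reversed-arc (proj₁ acO) (proj₁ acO′) O≢O′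
      in shortest-reversed (<-wellFounded (span a b)) a→b b→′a

-- Linear functionals on the vertices of P_G

  module Functional (c : Fin n → ℚ) where

    -- ⟨c , x(W)⟩ = Σᵢ cᵢ + ½ Σᵢ Σⱼ headWeight W i j
    headWeight : Ori n → Fin n → Fin n → ℚ
    headWeight W i j = c i ℚ.* ι (boolℕ (arc W j i)) ℚ.+ c j ℚ.* ι (boolℕ (arc W i j))

    private
      inWeight : Ori n → ℚ
      inWeight W = ℚΣ.sum (λ i → ℚΣ.sum (λ j → c i ℚ.* ι (boolℕ (arc W j i))))

      dot-point : ∀ W → dot c (point W) ≡ ℚΣ.sum c ℚ.+ inWeight W
      dot-point W = begin
        dot c (point W)                                ≡⟨ foldr-map-allFin ℚ._+_ 0ℚ (λ i → c i ℚ.* ι (point W i)) ⟩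
        ℚΣ.sum (λ i → c i ℚ.* ι (point W i))           ≡⟨ ℚΣ.sum-cong-≗ split ⟩
        ℚΣ.sum (λ i → c i ℚ.+ ℚΣ.sum (λ j → c i ℚ.* ι (boolℕ (arc W j i))))
                                                       ≡⟨ ℚΣ.∑-distrib-+ c _ ⟩
        ℚΣ.sum c ℚ.+ inWeight W                        ∎
        where
        open ≡-Reasoning
        split : ∀ i → c i ℚ.* ι (point W i) ≡ c i ℚ.+ ℚΣ.sum (λ j → c i ℚ.* ι (boolℕ (arc W j i)))
        split i = begin
          c i ℚ.* ι (suc (indeg W i))                    ≡⟨ cong (c i ℚ.*_) (ι-+ 1 (indeg W i)) ⟩
          c i ℚ.* (1ℚ ℚ.+ ι (indeg W i))                 ≡⟨ ℚP.*-distribˡ-+ (c i) 1ℚ _ ⟩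
          c i ℚ.* 1ℚ ℚ.+ c i ℚ.* ι (indeg W i)           ≡⟨ cong₂ ℚ._+_ (ℚP.*-identityʳ (c i))
                                                              (cong (λ k → c i ℚ.* ι k) (foldr-map-allFin ℕ._+_ 0 (λ j → boolℕ (arc W j i)))) ⟩
          c i ℚ.+ c i ℚ.* ι (ℕΣ.sum (λ j → boolℕ (arc W j i)))
                                                         ≡⟨ cong (λ q → c i ℚ.+ c i ℚ.* q) (ι-sum (λ j → boolℕ (arc W j i))) ⟩
          c i ℚ.+ c i ℚ.* ℚΣ.sum (λ j → ι (boolℕ (arc W j i)))
                                                         ≡⟨ cong (c i ℚ.+_) (ℚΣ.*-distribˡ-sum (c i) (λ j → ι (boolℕ (arc W j i)))) ⟩
          c i ℚ.+ ℚΣ.sum (λ j → c i ℚ.* ι (boolℕ (arc W j i))) ∎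

      inWeight-doubled : ∀ W → inWeight W ℚ.+ inWeight W ≡ ℚΣ.sum (λ i → ℚΣ.sum (headWeight W i))
      inWeight-doubled W = begin
        inWeight W ℚ.+ inWeight W
          ≡⟨ cong (inWeight W ℚ.+_) (ℚΣ.∑-comm (λ i j → c i ℚ.* ι (boolℕ (arc W j i)))) ⟩
        inWeight W ℚ.+ ℚΣ.sum (λ i → ℚΣ.sum (λ j → c j ℚ.* ι (boolℕ (arc W i j))))
          ≡⟨ ℚΣ.∑-distrib-+ (λ i → ℚΣ.sum (λ j → c i ℚ.* ι (boolℕ (arc W j i)))) _ ⟨
        ℚΣ.sum (λ i → ℚΣ.sum (λ j → c i ℚ.* ι (boolℕ (arc W j i))) ℚ.+ ℚΣ.sum (λ j → c j ℚ.* ι (boolℕ (arc W i j))))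
          ≡⟨ ℚΣ.sum-cong-≗ (λ i → ℚΣ.∑-distrib-+ (λ j → c i ℚ.* ι (boolℕ (arc W j i))) _) ⟨
        ℚΣ.sum (λ i → ℚΣ.sum (headWeight W i))
          ∎
        where open ≡-Reasoning

    dot-mono-≤ : ∀ {W W′} → (∀ i j → headWeight W i j ℚ.≤ headWeight W′ i j) → dot c (point W) ℚ.≤ dot c (point W′)
    dot-mono-≤ {W} {W′} hw≤hw′ =
      subst₂ ℚ._≤_ (sym (dot-point W)) (sym (dot-point W′)) (ℚP.+-monoʳ-≤ (ℚΣ.sum c) (x+x≤y+y⇒x≤y
        (subst₂ ℚ._≤_ (sym (inWeight-doubled W)) (sym (inWeight-doubled W′))
          (ℚΣ.sum-mono-≤ (λ i → ℚΣ.sum-mono-≤ (hw≤hw′ i))))))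

    dot-mono-< : ∀ {W W′} → (∀ i j → headWeight W i j ℚ.≤ headWeight W′ i j) →
                 ∀ k l → headWeight W k l ℚ.< headWeight W′ k l → dot c (point W) ℚ.< dot c (point W′)
    dot-mono-< {W} {W′} hw≤hw′ k l hw<hw′ =
      subst₂ ℚ._<_ (sym (dot-point W)) (sym (dot-point W′)) (ℚP.+-monoʳ-< (ℚΣ.sum c) (x+x<y+y⇒x<y
        (subst₂ ℚ._<_ (sym (inWeight-doubled W)) (sym (inWeight-doubled W′))
          (ℚΣ.sum-mono-< (λ i → ℚΣ.sum-mono-≤ (hw≤hw′ i)) k (ℚΣ.sum-mono-< (hw≤hw′ k) l hw<hw′)))))

    module _ (W : Ori n) (w : IsOrientation G W) where
      open Oriented W w

      headWeight-nonedge : ∀ {i j} → adj G i j ≡ false → headWeight W i j ≡ 0ℚ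
      headWeight-nonedge {i} {j} e = begin
        c i ℚ.* ι (boolℕ (arc W j i)) ℚ.+ c j ℚ.* ι (boolℕ (arc W i j))
          ≡⟨ cong₂ (λ x y → c i ℚ.* ι (boolℕ x) ℚ.+ c j ℚ.* ι (boolℕ y)) (nonedge-arc (trans (Graph.sym G j i) e)) (nonedge-arc e) ⟩
        c i ℚ.* 0ℚ ℚ.+ c j ℚ.* 0ℚ  ≡⟨ cong₂ ℚ._+_ (ℚP.*-zeroʳ (c i)) (ℚP.*-zeroʳ (c j)) ⟩
        0ℚ                         ∎
        where open ≡-Reasoning

      headWeight-arc : ∀ {i j} → Arc W i j → headWeight W i j ≡ c j
      headWeight-arc {i} {j} i→j = begin
        c i ℚ.* ι (boolℕ (arc W j i)) ℚ.+ c j ℚ.* ι (boolℕ (arc W i j))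
          ≡⟨ cong₂ (λ x y → c i ℚ.* ι (boolℕ x) ℚ.+ c j ℚ.* ι (boolℕ y)) (arc-asym i→j) i→j ⟩
        c i ℚ.* 0ℚ ℚ.+ c j ℚ.* 1ℚ  ≡⟨ cong₂ ℚ._+_ (ℚP.*-zeroʳ (c i)) (ℚP.*-identityʳ (c j)) ⟩
        0ℚ ℚ.+ c j                 ≡⟨ ℚP.+-identityˡ (c j) ⟩
        c j                        ∎
        where open ≡-Reasoning

      headWeight-arc⁻¹ : ∀ {i j} → Arc W j i → headWeight W i j ≡ c i
      headWeight-arc⁻¹ {i} {j} j→i = trans (ℚP.+-comm (c i ℚ.* _) _) (headWeight-arc j→i)

    Monotone : Ori n → Set
    Monotone M = ∀ {a b} → Arc M a b → c a ℚ.≤ c b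

    module _ (M : Ori n) (m : IsOrientation G M) (W : Ori n) (w : IsOrientation G W) (monotone : Monotone M) where

      headWeight-≤-monotone : ∀ i j → headWeight W i j ℚ.≤ headWeight M i j
      headWeight-≤-monotone i j = by-adjacency (adj G i j) refl
        where
        by-arcs : Arc M i j ⊎ Arc M j i → Arc W i j ⊎ Arc W j i → headWeight W i j ℚ.≤ headWeight M i j
        by-arcs (inj₁ i→ᴹj) (inj₁ i→ᵂj) = ℚP.≤-reflexive (trans (headWeight-arc W w i→ᵂj) (sym (headWeight-arc M m i→ᴹj)))
        by-arcs (inj₁ i→ᴹj) (inj₂ j→ᵂi) = subst₂ ℚ._≤_ (sym (headWeight-arc⁻¹ W w j→ᵂi)) (sym (headWeight-arc M m i→ᴹj)) (monotone i→ᴹj)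
        by-arcs (inj₂ j→ᴹi) (inj₁ i→ᵂj) = subst₂ ℚ._≤_ (sym (headWeight-arc W w i→ᵂj)) (sym (headWeight-arc⁻¹ M m j→ᴹi)) (monotone j→ᴹi)
        by-arcs (inj₂ j→ᴹi) (inj₂ j→ᵂi) = ℚP.≤-reflexive (trans (headWeight-arc⁻¹ W w j→ᵂi) (sym (headWeight-arc⁻¹ M m j→ᴹi)))

        by-adjacency : ∀ t → adj G i j ≡ t → headWeight W i j ℚ.≤ headWeight M i j
        by-adjacency false e = ℚP.≤-reflexive (trans (headWeight-nonedge W w e) (sym (headWeight-nonedge M m e)))
        by-adjacency true  e = by-arcs (Oriented.edge⇒arc⊎arc M m e) (Oriented.edge⇒arc⊎arc W w e)

      dot-≤-monotone : dot c (point W) ℚ.≤ dot c (point M)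
      dot-≤-monotone = dot-mono-≤ {W} {M} headWeight-≤-monotone

      dot-<-monotone : ∀ {a b} → Arc M a b → Arc W b a → c a ℚ.< c b → dot c (point W) ℚ.< dot c (point M)
      dot-<-monotone {a} {b} a→ᴹb b→ᵂa ca<cb = dot-mono-< {W} {M} headWeight-≤-monotone a b
        (subst₂ ℚ._<_ (sym (headWeight-arc⁻¹ W w b→ᵂa)) (sym (headWeight-arc M m a→ᴹb)) ca<cb)

    private
      module Key = IsStrictTotalOrder (×-isStrictTotalOrder ℚP.<-isStrictTotalOrder (FinP.<-isStrictTotalOrder {n}))

      _≺_ : Fin n → Fin n → Set
      a ≺ b = ×-Lex _≡_ ℚ._<_ Fin._<_ (c a , a) (c b , b)

      _≺?_ : ∀ a b → Dec (a ≺ b)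
      a ≺? b = (c a , a) Key.<? (c b , b)

    orientBy : Ori n
    orientBy = tabulate (λ a → tabulate (λ b → adj G a b ∧ does (a ≺? b)))

    private
      arc-orientBy : ∀ a b → arc orientBy a b ≡ adj G a b ∧ does (a ≺? b)
      arc-orientBy a b = trans (cong (λ row → lookup row b) (VecP.lookup∘tabulate _ a)) (VecP.lookup∘tabulate _ b)

      orientBy⇒≺ : ∀ {a b} → Arc orientBy a b → a ≺ b
      orientBy⇒≺ {a} {b} a→b with adj G a b | a ≺? b | trans (sym (arc-orientBy a b)) a→b
      ... | true | yes a≺b | _ = a≺b

      ≺⇒orientBy : ∀ {a b} → adj G a b ≡ true → a ≺ b → Arc orientBy a b
      ≺⇒orientBy {a} {b} e a≺b = trans (arc-orientBy a b) (cong₂ _∧_ e (dec-true (a ≺? b) a≺b))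

      ≺-asym : ∀ {a b} → a ≢ b → does (a ≺? b) ≡ not (does (b ≺? a))
      ≺-asym {a} {b} a≢b = from-tri (Key.compare (c a , a) (c b , b))
        where
        from-tri : Tri (a ≺ b) _ (b ≺ a) → does (a ≺? b) ≡ not (does (b ≺? a))
        from-tri (tri< a≺b _ b⊀a)   = trans (dec-true (a ≺? b) a≺b) (cong not (sym (dec-false (b ≺? a) b⊀a)))
        from-tri (tri> a⊀b _ b≺a)   = trans (dec-false (a ≺? b) a⊀b) (cong not (sym (dec-true (b ≺? a) b≺a)))
        from-tri (tri≈ _ (_ , a≡b) _) = contradiction a≡b a≢b

    orientBy-isOrientation : IsOrientation G orientBy
    orientBy-isOrientation = isOrientation {orientBy} edge nonedge
      where
      edge : ∀ {a b} → adj G a b ≡ true → arc orientBy a b ≡ not (arc orientBy b a)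
      edge {a} {b} e = begin
        arc orientBy a b            ≡⟨ arc-orientBy a b ⟩
        adj G a b ∧ does (a ≺? b)   ≡⟨ cong₂ _∧_ e (≺-asym a≢b) ⟩
        not (does (b ≺? a))         ≡⟨ cong (λ t → not (t ∧ does (b ≺? a))) (trans (Graph.sym G b a) e) ⟨
        not (adj G b a ∧ does (b ≺? a)) ≡⟨ cong not (arc-orientBy b a) ⟨
        not (arc orientBy b a)      ∎
        where
        open ≡-Reasoning
        a≢b : a ≢ b
        a≢b refl = contradiction (trans (sym e) (Graph.irrefl G a)) λ ()
      nonedge : ∀ {a b} → adj G a b ≡ false → arc orientBy a b ≡ false
      nonedge {a} {b} e = trans (arc-orientBy a b) (cong (_∧ does (a ≺? b)) e)

    orientBy-Acyclic : Acyclic G orientBy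
    orientBy-Acyclic = orientBy-isOrientation ,
      λ x x<x → Key.irrefl (refl , refl) (transitive⁻ _ Key.trans (TC-map orientBy⇒≺ x<x))

    orientBy-monotone : Monotone orientBy
    orientBy-monotone a→b with orientBy⇒≺ a→b
    ... | inj₁ ca<cb        = ℚP.<⇒≤ ca<cb
    ... | inj₂ (ca≡cb , _) = ℚP.≤-reflexive ca≡cb

    orientBy-upward : ∀ {a b} → adj G a b ≡ true → c a ℚ.< c b → Arc orientBy a b
    orientBy-upward e ca<cb = ≺⇒orientBy e (inj₁ ca<cb)

    maximiser-monotone : ∀ {O} → IsOrientation G O → (∀ W → Acyclic G W → dot c (point W) ℚ.≤ dot c (point O)) → Monotone O
    maximiser-monotone {O} o maximal {a} {b} a→b = ℚP.≮⇒≥ λ cb<ca → ℚP.<-irrefl refl (ℚP.<-≤-trans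
      (dot-<-monotone orientBy orientBy-isOrientation O o orientBy-monotone
        (orientBy-upward (adj-sym (Oriented.arc⇒adj O o a→b)) cb<ca) a→b cb<ca)
      (maximal orientBy orientBy-Acyclic))

-- Cover reversals are exactly the edges of the 1-skeleton

  module _ (O : Ori n) (acO : Acyclic G O) (u v : Fin n) (cover : Cover O (u , v)) where
    private
      O′ = rev O (u , v)
      acO′ = CoverReversal.rev-Acyclic O acO u v cover
      open ArcReversal O (proj₁ acO) u v (proj₁ cover)
      module h  = StrictOrder O (proj₂ acO)
      module h′ = StrictOrder O′ (proj₂ acO′)
      hu<hv : h.#below u ℕ.< h.#below v
      hu<hv = h.#below-mono-< [ proj₁ cover ]
      h′v<h′u : h′.#below v ℕ.< h′.#below u
      h′v<h′u = h′.#below-mono-< [ arc-rev-vu O u≢v ]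
      α = h′.#below u ℕ.∸ h′.#below v
      β = h.#below v ℕ.∸ h.#below u

      potentialℕ : Fin n → ℕ
      potentialℕ w = α ℕ.* h.#below w ℕ.+ β ℕ.* h′.#below w

    abstract
      potential : Fin n → ℚ
      potential = ι ∘ potentialℕ

      -- #below rises by β along u → v in O and #below′ falls by α along v → u in O′: the αβ's cancel
      potential-u≡v : potential u ≡ potential v
      potential-u≡v = cong ι (begin
        α ℕ.* h.#below u ℕ.+ β ℕ.* h′.#below u             ≡⟨ cong (λ k → α ℕ.* h.#below u ℕ.+ β ℕ.* k) (ℕP.m+[n∸m]≡n (ℕP.<⇒≤ h′v<h′u)) ⟨
        α ℕ.* h.#below u ℕ.+ β ℕ.* (h′.#below v ℕ.+ α)     ≡⟨ regroup α (h.#below u) β (h′.#below v) ⟩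
        α ℕ.* (h.#below u ℕ.+ β) ℕ.+ β ℕ.* h′.#below v     ≡⟨ cong (λ k → α ℕ.* k ℕ.+ β ℕ.* h′.#below v) (ℕP.m+[n∸m]≡n (ℕP.<⇒≤ hu<hv)) ⟩
        α ℕ.* h.#below v ℕ.+ β ℕ.* h′.#below v             ∎)
        where
        open ≡-Reasoning
        open +-*-Solver
        regroup : ∀ α x β y → α ℕ.* x ℕ.+ β ℕ.* (y ℕ.+ α) ≡ α ℕ.* (x ℕ.+ β) ℕ.+ β ℕ.* y
        regroup = solve 4 (λ α x β y → α :* x :+ β :* (y :+ α) := α :* (x :+ β) :+ β :* y) refl

      potential-increasing : ∀ {a b} → ArcExcept O (u , v) a b → potential a ℚ.< potential b
      potential-increasing a→b = ι-mono-< (ℕP.+-mono-<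
        (ℕP.*-monoʳ-< α ⦃ ℕ.>-nonZero (ℕP.m<n⇒0<n∸m h′v<h′u) ⦄ (h.#below-mono-< [ proj₁ a→b ]))
        (ℕP.*-monoʳ-< β ⦃ ℕ.>-nonZero (ℕP.m<n⇒0<n∸m hu<hv) ⦄ (h′.#below-mono-< [ ArcExcept⇒arc-rev a→b ])))

    reversed-arc-except : ∀ {W} → IsOrientation G W → W ≢ O → W ≢ O′ →
                          ∃ λ a → ∃ λ b → ArcExcept O (u , v) a b × Arc W b a
    reversed-arc-except {W} w W≢O W≢O′ with ≢⇒reversed-arc (proj₁ acO) w (W≢O ∘ sym)
    ... | a , b , a→b , b→ᵂa with (a , b) ≟² (u , v)
    ...   | no ≢uv   = a , b , (a→b , ≢uv) , b→ᵂa
    ...   | yes refl with ≢⇒reversed-arc (proj₁ acO′) w (W≢O′ ∘ sym)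
    ...     | p , q , p→′q , q→ᵂp with arc-rev⇒ p→′q
    ...       | inj₁ refl = contradiction (trans (sym q→ᵂp) (Oriented.arc-asym W w b→ᵂa)) λ ()
    ...       | inj₂ p→q  = p , q , p→q , q→ᵂp

    cover⇒SkelAdj : SkelAdj G O O′
    cover⇒SkelAdj = rev-≢ ∘ sym , potential ,
      ℚP.≤-antisym (dot-≤-monotone O′ (proj₁ acO′) O (proj₁ acO) monotone-O′)
                   (dot-≤-monotone O (proj₁ acO) O′ (proj₁ acO′) monotone-O) ,
      strict
      where
      open Functional potential

      monotone-O : Monotone O
      monotone-O {a} {b} a→b = by-pair ((a , b) ≟² (u , v))
        where
        by-pair : Dec ((a , b) ≡ (u , v)) → potential a ℚ.≤ potential b
        by-pair (yes ab≡uv) = subst (λ (x , y) → potential x ℚ.≤ potential y) (sym ab≡uv) (ℚP.≤-reflexive potential-u≡v)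
        by-pair (no ≢uv)    = ℚP.<⇒≤ (potential-increasing (a→b , ≢uv))

      monotone-O′ : Monotone O′
      monotone-O′ a→b = by-arc (arc-rev⇒ a→b)
        where
        by-arc : ∀ {a b} → (a , b) ≡ (v , u) ⊎ ArcExcept O (u , v) a b → potential a ℚ.≤ potential b
        by-arc (inj₁ refl) = ℚP.≤-reflexive (sym potential-u≡v)
        by-arc (inj₂ a→b)  = ℚP.<⇒≤ (potential-increasing a→b)

      strict : ∀ W → Acyclic G W → W ≢ O → W ≢ O′ → dot potential (point W) ℚ.< dot potential (point O)
      strict W acW W≢O W≢O′ =
        let (a , b , a→b , b→ᵂa) = reversed-arc-except (proj₁ acW) W≢O W≢O′
        in dot-<-monotone O (proj₁ acO) W (proj₁ acW) monotone-O (proj₁ a→b) b→ᵂa (potential-increasing a→b)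

  SkelAdj⇒CRStep : ∀ {O O′} → Acyclic G O → Acyclic G O′ → SkelAdj G O O′ → CRStep O O′
  SkelAdj⇒CRStep {O} {O′} acO acO′ (O≢O′ , c , dotO≡dotO′ , strict) = from-reversed (cover-reversed acO acO′ O≢O′)
    where
    open Functional c

    maximal : ∀ X → Acyclic G X → dot c (point X) ℚ.≤ dot c (point O)
    maximal X acX = by-cases (X ≟ₒ O) (X ≟ₒ O′)
      where
      by-cases : Dec (X ≡ O) → Dec (X ≡ O′) → dot c (point X) ℚ.≤ dot c (point O)
      by-cases (yes X≡O) _         = ℚP.≤-reflexive (cong (dot c ∘ point) X≡O)
      by-cases (no _)    (yes X≡O′) = ℚP.≤-reflexive (trans (cong (dot c ∘ point) X≡O′) (sym dotO≡dotO′))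
      by-cases (no X≢O)  (no X≢O′)  = ℚP.<⇒≤ (strict X acX X≢O X≢O′)

    monotone-O : Monotone O
    monotone-O = maximiser-monotone {O} (proj₁ acO) maximal

    monotone-O′ : Monotone O′
    monotone-O′ = maximiser-monotone {O′} (proj₁ acO′) (λ X acX → subst (dot c (point X) ℚ.≤_) dotO≡dotO′ (maximal X acX))

    from-reversed : (∃ λ u → ∃ λ v → Cover O (u , v) × Arc O′ v u) → CRStep O O′
    from-reversed (u , v , cover , v→′u) = (u , v) , cover , decidable-stable (W ≟ₒ O′) W≡O′
      where
      W = rev O (u , v)
      acW = CoverReversal.rev-Acyclic O acO u v cover

      monotone-W : Monotone W
      monotone-W a→b = by-arc (ArcReversal.arc-rev⇒ O (proj₁ acO) u v (proj₁ cover) a→b)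
        where
        by-arc : ∀ {a b} → (a , b) ≡ (v , u) ⊎ ArcExcept O (u , v) a b → c a ℚ.≤ c b
        by-arc (inj₁ refl)  = ℚP.≤-reflexive (ℚP.≤-antisym (monotone-O′ v→′u) (monotone-O (proj₁ cover)))
        by-arc (inj₂ a→ᴼb) = monotone-O (proj₁ a→ᴼb)

      W≡O′ : ¬ W ≢ O′
      W≡O′ W≢O′ = ℚP.<-irrefl refl (ℚP.<-≤-trans
        (strict W acW (ArcReversal.rev-≢ O (proj₁ acO) u v (proj₁ cover)) W≢O′)
        (dot-≤-monotone W (proj₁ acW) O (proj₁ acO) monotone-W))

-- The skeleton is a simple, bipartite, connected graph

  ascending : Fin n → Fin n → Bool
  ascending a b = does (a FinP.<? b)

  colour : Ori n → Bool
  colour O = ⊕Σ.sum (λ a → ⊕Σ.sum (λ b → ascending a b ∧ arc O a b))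

  module _ (O : Ori n) (o : IsOrientation G O) (u v : Fin n) (u→v : Arc O u v) where
    open ArcReversal O o u v u→v

    private
      term : Ori n → Fin n → Fin n → Bool
      term X a b = ascending a b ∧ arc X a b

      term-uv : term (rev O (u , v)) u v ≡ false
      term-uv = trans (cong (ascending u v ∧_) (arc-rev-uv O u≢v)) (BoolP.∧-zeroʳ _)

      term-vu : term O v u ≡ false
      term-vu = trans (cong (ascending v u ∧_) (Oriented.arc-asym O o u→v)) (BoolP.∧-zeroʳ _)

      term-elsewhere : ∀ {a b} → (a , b) ≢ (u , v) → (a , b) ≢ (v , u) → term O a b ≡ term (rev O (u , v)) a b
      term-elsewhere {a} {b} ≢uv ≢vu = cong (ascending a b ∧_) (sym (arc-rev-elsewhere O u≢v ≢uv ≢vu))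

      descending-term : ∀ {a b} → ¬ a Fin.< b → ∀ X → term X a b ≡ false
      descending-term {a} {b} a≮b X = cong (_∧ arc X a b) (dec-false (a FinP.<? b) a≮b)

    colour-rev : colour (rev O (u , v)) ≡ not (colour O)
    colour-rev with FinP.<-cmp u v
    ... | tri< u<v _ v≮u = ⊕Σ.sum²-flip u v unchanged
      (trans term-uv (cong not (sym (trans (cong (_∧ arc O u v) (dec-true (u FinP.<? v) u<v)) u→v))))
      where
      unchanged : ∀ a b → (a , b) ≢ (u , v) → term O a b ≡ term (rev O (u , v)) a b
      unchanged a b ≢uv′ with pairView u v a b
      ... | at-uv = contradiction refl ≢uv′
      ... | at-vu = trans (descending-term v≮u O) (sym (descending-term v≮u (rev O (u , v))))
      ... | elsewhere ≢uv ≢vu = term-elsewhere ≢uv ≢vu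
    ... | tri> u≮v _ v<u = ⊕Σ.sum²-flip v u unchanged
      (trans (cong (_∧ arc (rev O (u , v)) v u) (dec-true (v FinP.<? u) v<u)) (trans (arc-rev-vu O u≢v) (cong not (sym term-vu))))
      where
      unchanged : ∀ a b → (a , b) ≢ (v , u) → term O a b ≡ term (rev O (u , v)) a b
      unchanged a b ≢vu′ with pairView u v a b
      ... | at-uv = trans (descending-term u≮v O) (sym (descending-term u≮v (rev O (u , v))))
      ... | at-vu = contradiction refl ≢vu′
      ... | elsewhere ≢uv ≢vu = term-elsewhere ≢uv ≢vu
    ... | tri≈ _ u≡v _ = contradiction u≡v u≢v

  walk-colour : ∀ {t O O′} → Acyclic G O → Walk t O O′ →
                (colour O′ ≡ colour O × 2 ∣ t) ⊎ (colour O′ ≡ not (colour O) × 2 ∣ suc t)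
  walk-colour acO here = inj₁ (refl , 2 ∣0)
  walk-colour {O = O} acO (step ((u , v) , cover , refl) walk)
    with walk-colour (CoverReversal.rev-Acyclic O acO u v cover) walk
  ... | inj₁ (same , 2∣t)       = inj₂ (trans same (colour-rev O (proj₁ acO) u v (proj₁ cover)) , ∣m∣n⇒∣m+n ∣-refl 2∣t)
  ... | inj₂ (flipped , 2∣1+t) = inj₁ (trans flipped (trans (cong not (colour-rev O (proj₁ acO) u v (proj₁ cover)))
                                                             (BoolP.not-involutive (colour O))) , 2∣1+t)

  closed-walk-even : ∀ {t O} → Acyclic G O → Walk t O O → 2 ∣ t
  closed-walk-even acO walk with walk-colour acO walk
  ... | inj₁ (_ , 2∣t)  = 2∣t
  ... | inj₂ (flipped , _) = contradiction flipped (BoolP.not-¬ refl)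

  -- O differs from the orientation along decreasing #below on every edge.
  cover-exists : HasEdge G → ∀ {O} → Acyclic G O → ∃ λ u → ∃ λ v → Cover O (u , v)
  cover-exists (a , b , e) {O} acO =
    let (u , v , cover , _) = cover-reversed acO orientBy-Acyclic O≢reversed in u , v , cover
    where
    open StrictOrder O (proj₂ acO)
    open Oriented O (proj₁ acO)
    c : Fin n → ℚ
    c x = ℚ.- ι (#below x)
    open Functional c

    some-arc : ∃ λ x → ∃ λ y → Arc O x y
    some-arc with edge⇒arc⊎arc e
    ... | inj₁ a→b = a , b , a→b
    ... | inj₂ b→a = b , a , b→a

    O≢reversed : O ≢ orientBy
    O≢reversed O≡ =
      let (x , y , x→y) = some-arc
          y→x = orientBy-upward (adj-sym (arc⇒adj x→y)) (ℚP.neg-antimono-< (ι-mono-< (#below-mono-< [ x→y ])))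
      in contradiction (trans (sym (arc-asym x→y)) (trans (cong (λ X → arc X y x) O≡) y→x)) λ ()

  period-two : HasEdge G → ∀ O → Acyclic G O → IsPeriod O 2
  period-two he O acO = (λ t → closed-walk-even acO) , λ d d∣closed → d∣closed 2 there-and-back
    where
    there-and-back : Walk 2 O O
    there-and-back =
      let (u , v , cover) = cover-exists he {O} acO
      in step ((u , v) , cover , refl)
           (step ((v , u) , CoverReversal.rev-Cover O acO u v cover , ArcReversal.rev-involutive O (proj₁ acO) u v (proj₁ cover))
             here)

  disagreements : Ori n → Ori n → ℕ
  disagreements X Y = ℕΣ.sum (λ a → ℕΣ.sum (λ b → boolℕ (arc X a b xor arc Y a b)))

  module _ {O O′ : Ori n} (acO : Acyclic G O) (acO′ : Acyclic G O′) {u v : Fin n} (u→v : Arc O u v) (v→′u : Arc O′ v u) where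
    open ArcReversal O (proj₁ acO) u v u→v

    private
      entry : Ori n → Fin n → Fin n → ℕ
      entry X a b = boolℕ (arc X a b xor arc O′ a b)

      u↛′v : arc O′ u v ≡ false
      u↛′v = Oriented.arc-asym O′ (proj₁ acO′) v→′u

      entry-≤ : ∀ a b → entry (rev O (u , v)) a b ℕ.≤ entry O a b
      entry-≤ a b with pairView u v a b
      ... | at-uv = subst (ℕ._≤ entry O u v) (sym (cong₂ (λ x y → boolℕ (x xor y)) (arc-rev-uv O u≢v) u↛′v)) z≤n
      ... | at-vu = subst (ℕ._≤ entry O v u) (sym (cong₂ (λ x y → boolℕ (x xor y)) (arc-rev-vu O u≢v) v→′u)) z≤n
      ... | elsewhere ≢uv ≢vu = ℕP.≤-reflexive (cong (λ x → boolℕ (x xor arc O′ a b)) (arc-rev-elsewhere O u≢v ≢uv ≢vu))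

      entry-uv-< : entry (rev O (u , v)) u v ℕ.< entry O u v
      entry-uv-< = subst₂ ℕ._<_ (sym (cong₂ (λ x y → boolℕ (x xor y)) (arc-rev-uv O u≢v) u↛′v))
                                (sym (cong₂ (λ x y → boolℕ (x xor y)) u→v u↛′v)) (s≤s z≤n)

    disagreements-rev : disagreements (rev O (u , v)) O′ ℕ.< disagreements O O′
    disagreements-rev = ℕΣ.sum-mono-< (λ a → ℕΣ.sum-mono-≤ (entry-≤ a)) u (ℕΣ.sum-mono-< (entry-≤ u) v entry-uv-<)

  skeleton-connected : SkelConnected G
  skeleton-connected O O′ acO acO′ = path-to-O′ (<-wellFounded _) acO
    where
    path-to-O′ : ∀ {X} → Acc ℕ._<_ (disagreements X O′) → Acyclic G X → Star (SkelEdge G) X O′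
    path-to-O′ {X} (acc closer) acX = by-cases (X ≟ₒ O′)
      where
      by-cases : Dec (X ≡ O′) → Star (SkelEdge G) X O′
      by-cases (yes X≡O′) = subst (λ Y → Star (SkelEdge G) Y O′) (sym X≡O′) ε
      by-cases (no X≢O′)  =
        let (u , v , cover , v→′u) = cover-reversed acX acO′ X≢O′
            acX′ = CoverReversal.rev-Acyclic X acX u v cover
        in (acX , acX′ , cover⇒SkelAdj X acX u v cover)
           ◅ path-to-O′ (closer (disagreements-rev {X} {O′} acX acO′ {u} {v} (proj₁ cover) v→′u)) acX′

  skeleton-simple : SkelSimple G
  skeleton-simple = (λ O adjacent → proj₁ adjacent refl) ,
    λ { O O′ (O≢O′ , c , dot≡ , strict) → O≢O′ ∘ sym , c , sym dot≡ ,
          λ W acW W≢O′ W≢O → subst (dot c (point W) ℚ.<_) dot≡ (strict W acW W≢O W≢O′) }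

  skeleton-bipartite : SkelBipartite G
  skeleton-bipartite = colour , λ { O O′ (acO , acO′ , adjacent) same → differ acO (SkelAdj⇒CRStep acO acO′ adjacent) same }
    where
    differ : ∀ {O O′} → Acyclic G O → CRStep O O′ → colour O ≢ colour O′
    differ {O} acO ((u , v) , cover , refl) same =
      BoolP.not-¬ refl (trans same (colour-rev O (proj₁ acO) u v (proj₁ cover)))

  CR-isSRW : CRisSRW G
  CR-isSRW O acO =
    (λ { (u , v) cover → CoverReversal.rev-Acyclic O acO u v cover , cover⇒SkelAdj O acO u v cover }) ,
    (λ { (u , v) _ cover cover′ rev≡rev → ArcReversal.rev-injective O (proj₁ acO) u v (proj₁ cover) (proj₁ cover′) rev≡rev }) ,
    λ O′ acO′ → SkelAdj⇒CRStep acO acO′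

-- The stationary distribution

  module Stationary (he : HasEdge G) (AO : List (Ori n)) (AO-unique : Unique AO)
                    (AO-spec : ∀ O → (O ∈ AO) ⇔ Acyclic G O)
                    (cov : Ori n → List (Fin n × Fin n))
                    (cov-spec : ∀ O → Acyclic G O → Unique (cov O) × (∀ e → (e ∈ cov O) ⇔ Cover O e)) where

    private
      ∈AO⇒acyclic : ∀ {O} → O ∈ AO → Acyclic G O
      ∈AO⇒acyclic {O} = Equivalence.to (AO-spec O)

      acyclic⇒∈AO : ∀ {O} → Acyclic G O → O ∈ AO
      acyclic⇒∈AO {O} = Equivalence.from (AO-spec O)

      ∈cov⇒cover : ∀ {O} → Acyclic G O → ∀ {e} → e ∈ cov O → Cover O e
      ∈cov⇒cover {O} acO {e} = Equivalence.to (proj₂ (cov-spec O acO) e)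

      cover⇒∈cov : ∀ {O} → Acyclic G O → ∀ {e} → Cover O e → e ∈ cov O
      cover⇒∈cov {O} acO {e} = Equivalence.from (proj₂ (cov-spec O acO) e)

      some∈AO : Functional.orientBy (λ _ → 0ℚ) ∈ AO
      some∈AO = acyclic⇒∈AO (Functional.orientBy-Acyclic (λ _ → 0ℚ))

      rev-∈AO : ∀ {O} → Acyclic G O → ∀ {e} → e ∈ cov O → rev O e ∈ AO
      rev-∈AO {O} acO {u , v} e∈ = acyclic⇒∈AO (CoverReversal.rev-Acyclic O acO u v (∈cov⇒cover acO e∈))

    #cov : Ori n → ℕ
    #cov O = length (cov O)

    #steps : Ori n → Ori n → ℕ
    #steps O O′ = count (λ e → rev O e ≟ₒ O′) (cov O)

    #cov-pos : ∀ {O} → Acyclic G O → 0 ℕ.< #cov O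
    #cov-pos {O} acO = let (u , v , cover) = cover-exists he {O} acO in ∈-length (cover⇒∈cov acO cover)

    step-back : ∀ {O O′} → Acyclic G O → ∀ {e} → e ∈ cov O → rev O e ≡ O′ → swap e ∈ cov O′ × rev O′ (swap e) ≡ O
    step-back {O} acO {u , v} e∈ refl =
      cover⇒∈cov acO′ (CoverReversal.rev-Cover O acO u v cover) , ArcReversal.rev-involutive O (proj₁ acO) u v (proj₁ cover)
      where
      cover = ∈cov⇒cover acO e∈
      acO′ = CoverReversal.rev-Acyclic O acO u v cover

    #steps-one : ∀ {O O′} → Acyclic G O → ∀ {e} → e ∈ cov O → rev O e ≡ O′ → #steps O O′ ≡ 1
    #steps-one {O} {O′} acO = count-unique (λ e → rev O e ≟ₒ O′) (proj₁ (cov-spec O acO)) same-step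
      where
      same-step : ∀ {e e′} → e ∈ cov O → e′ ∈ cov O → rev O e ≡ O′ → rev O e′ ≡ O′ → e ≡ e′
      same-step {u , v} e∈ e′∈ e↦O′ e′↦O′ = ArcReversal.rev-injective O (proj₁ acO) u v
        (proj₁ (∈cov⇒cover acO e∈)) (proj₁ (∈cov⇒cover acO e′∈)) (trans e↦O′ (sym e′↦O′))

    #steps-sym : ∀ {O O′} → Acyclic G O → Acyclic G O′ → #steps O O′ ≡ #steps O′ O
    #steps-sym {O} {O′} acO acO′ = by-cases (Any.any? (λ e → rev O e ≟ₒ O′) (cov O))
      where
      by-cases : Dec (Any.Any (λ e → rev O e ≡ O′) (cov O)) → #steps O O′ ≡ #steps O′ O
      by-cases (yes stepping) =
        let (e , e∈ , e↦O′) = find stepping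
            (e′∈ , e′↦O) = step-back acO e∈ e↦O′
        in trans (#steps-one acO e∈ e↦O′) (sym (#steps-one acO′ e′∈ e′↦O))
      by-cases (no ¬stepping) =
        trans (count-none _ (cov O) (λ e∈ e↦O′ → ¬stepping (lose e∈ e↦O′)))
              (sym (count-none _ (cov O′) (λ e∈ e↦O → let (e′∈ , e′↦O′) = step-back acO′ e∈ e↦O in ¬stepping (lose e′∈ e′↦O′))))

    sum-steps-into : ∀ (w : Ori n → ℚ) {O′} → Acyclic G O′ → sumL (λ O → w O ℚ.* ι (#steps O O′)) AO ≡ sumL (w ∘ rev O′) (cov O′)
    sum-steps-into w {O′} acO′ = trans
      (sumL-cong AO (λ {O} O∈ → cong (λ k → w O ℚ.* ι k) (#steps-sym (∈AO⇒acyclic O∈) acO′)))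
      (sumL-fibres _≟ₒ_ w (rev O′) AO-unique (cov O′) (rev-∈AO acO′))

    transP-weighted : ∀ ρ O O′ → (ρ ℚ.* ι (#cov O)) ℚ.* transP cov O O′ ≡ ρ ℚ.* ι (#steps O O′)
    transP-weighted ρ O O′ = trans (ℚP.*-assoc ρ _ _) (cong (ρ ℚ.*_) (ι-*-frac (ListP.length-filter (λ e → rev O e ≟ₒ O′) (cov O))))

    total : ℚ
    total = sumL (ι ∘ #cov) AO

    total-pos : 0ℚ ℚ.< total
    total-pos = ℚP.<-≤-trans (ι-mono-< (∈-length some∈AO)) (begin
      ι (length AO)                ≡⟨ ℚP.*-identityˡ _ ⟨
      1ℚ ℚ.* ι (length AO)         ≡⟨ sumL-const 1ℚ AO ⟨
      sumL (λ _ → 1ℚ) AO           ≤⟨ sumL-mono-≤ AO (λ O∈ → ι-mono-≤ (#cov-pos (∈AO⇒acyclic O∈))) ⟩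
      total                        ∎)
      where open ℚP.≤-Reasoning

    instance
      total-positive : ℚ.Positive total
      total-positive = ℚ.positive total-pos

    c : ℚ
    c = (ℚ.1/ total) ⦃ ℚP.pos⇒nonZero total ⦄

    c-pos : 0ℚ ℚ.< c
    c-pos = ℚP.positive⁻¹ c ⦃ ℚP.1/pos⇒pos total ⦄

    c*total≡1 : c ℚ.* total ≡ 1ℚ
    c*total≡1 = ℚP.*-inverseˡ total ⦃ ℚP.pos⇒nonZero total ⦄

    π-CR : Ori n → ℚ
    π-CR O = c ℚ.* covSize cov O

    π-CR-stationary : IsStationary AO cov π-CR
    π-CR-stationary = nonneg , normalised , balanced
      where
      nonneg : ∀ O → O ∈ AO → 0ℚ ℚ.≤ π-CR O
      nonneg O _ = subst (ℚ._≤ π-CR O) (ℚP.*-zeroʳ c)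
        (ℚP.*-monoˡ-≤-nonNeg c ⦃ ℚP.pos⇒nonNeg c ⦃ ℚP.1/pos⇒pos total ⦄ ⦄ (ι-mono-≤ {0} {#cov O} z≤n))

      normalised : sumℚ (List.map π-CR AO) ≡ 1ℚ
      normalised = trans (sumL-*ˡ c (ι ∘ #cov) AO) c*total≡1

      balanced : ∀ O′ → O′ ∈ AO → π-CR O′ ≡ sumℚ (List.map (λ O → π-CR O ℚ.* transP cov O O′) AO)
      balanced O′ O′∈ = sym (begin
        sumL (λ O → π-CR O ℚ.* transP cov O O′) AO ≡⟨ sumL-cong AO (λ {O} _ → transP-weighted c O O′) ⟩
        sumL (λ O → c ℚ.* ι (#steps O O′)) AO      ≡⟨ sum-steps-into (λ _ → c) (∈AO⇒acyclic O′∈) ⟩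
        sumL (λ _ → c) (cov O′)                    ≡⟨ sumL-const c (cov O′) ⟩
        π-CR O′                                    ∎)
        where open ≡-Reasoning

    module _ (π : Ori n → ℚ) (π-stationary : IsStationary AO cov π) where
      private
        -- π / |Cov|, where the junk value frac 1 0 = 0 never occurs on AO
        ρ : Ori n → ℚ
        ρ O = π O ℚ.* frac 1 (#cov O)

        π≡ρ*#cov : ∀ {O} → O ∈ AO → π O ≡ ρ O ℚ.* ι (#cov O)
        π≡ρ*#cov {O} O∈ = sym (begin
          (π O ℚ.* frac 1 (#cov O)) ℚ.* ι (#cov O)   ≡⟨ ℚP.*-assoc (π O) _ _ ⟩
          π O ℚ.* (frac 1 (#cov O) ℚ.* ι (#cov O))   ≡⟨ cong (π O ℚ.*_) (ℚP.*-comm (frac 1 (#cov O)) _) ⟩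
          π O ℚ.* (ι (#cov O) ℚ.* frac 1 (#cov O))   ≡⟨ cong (π O ℚ.*_) (ι-*-frac (#cov-pos (∈AO⇒acyclic O∈))) ⟩
          π O ℚ.* 1ℚ                                 ≡⟨ ℚP.*-identityʳ (π O) ⟩
          π O                                        ∎)
          where open ≡-Reasoning

        ρ-harmonic : ∀ {O′} → O′ ∈ AO → ρ O′ ℚ.* ι (#cov O′) ≡ sumL (ρ ∘ rev O′) (cov O′)
        ρ-harmonic {O′} O′∈ = begin
          ρ O′ ℚ.* ι (#cov O′)                      ≡⟨ π≡ρ*#cov O′∈ ⟨
          π O′                                      ≡⟨ proj₂ (proj₂ π-stationary) O′ O′∈ ⟩
          sumL (λ O → π O ℚ.* transP cov O O′) AO   ≡⟨ sumL-cong AO (λ {O} O∈ → trans (cong (ℚ._* transP cov O O′) (π≡ρ*#cov O∈))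
                                                                                       (transP-weighted (ρ O) O O′)) ⟩
          sumL (λ O → ρ O ℚ.* ι (#steps O O′)) AO   ≡⟨ sum-steps-into ρ (∈AO⇒acyclic O′∈) ⟩
          sumL (ρ ∘ rev O′) (cov O′)                ∎
          where open ≡-Reasoning

        maximiser : ∃ λ top → top ∈ AO × (∀ {O} → O ∈ AO → ρ O ℚ.≤ ρ top)
        maximiser = argmax ρ AO some∈AO

        M : ℚ
        M = ρ (proj₁ maximiser)

        maximum-spreads : ∀ {X Y} → X ∈ AO → CRStep X Y → ρ X ≡ M → ρ Y ≡ M
        maximum-spreads {X} X∈ (e , cover , refl) ρX≡M =
          sumL-≤-≡⇒≡ (cov X) (λ e∈ → proj₂ (proj₂ maximiser) (rev-∈AO acX e∈)) neighbours-sum (cover⇒∈cov acX cover)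
          where
          acX = ∈AO⇒acyclic X∈
          neighbours-sum : sumL (ρ ∘ rev X) (cov X) ≡ sumL (λ _ → M) (cov X)
          neighbours-sum = trans (sym (ρ-harmonic X∈)) (trans (cong (ℚ._* ι (#cov X)) ρX≡M) (sym (sumL-const M (cov X))))

        ρ-constant : ∀ {O} → O ∈ AO → ρ O ≡ M
        ρ-constant O∈ = along (skeleton-connected _ _ (∈AO⇒acyclic (proj₁ (proj₂ maximiser))) (∈AO⇒acyclic O∈)) refl
          where
          along : ∀ {X Y} → Star (SkelEdge G) X Y → ρ X ≡ M → ρ Y ≡ M
          along ε = id
          along ((acX , acY , adjacent) ◅ path) = along path ∘ maximum-spreads (acyclic⇒∈AO acX) (SkelAdj⇒CRStep acX acY adjacent)

        M≡c : M ≡ c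
        M≡c = begin
          M                          ≡⟨ ℚP.*-identityʳ M ⟨
          M ℚ.* 1ℚ                   ≡⟨ cong (M ℚ.*_) (trans (ℚP.*-comm total c) c*total≡1) ⟨
          M ℚ.* (total ℚ.* c)        ≡⟨ ℚP.*-assoc M total c ⟨
          (M ℚ.* total) ℚ.* c        ≡⟨ cong (ℚ._* c) M*total≡1 ⟩
          1ℚ ℚ.* c                   ≡⟨ ℚP.*-identityˡ c ⟩
          c                          ∎
          where
          open ≡-Reasoning
          M*total≡1 : M ℚ.* total ≡ 1ℚ
          M*total≡1 = begin
            M ℚ.* total                        ≡⟨ sumL-*ˡ M (ι ∘ #cov) AO ⟨
            sumL (λ O → M ℚ.* ι (#cov O)) AO   ≡⟨ sumL-cong AO (λ O∈ → trans (cong (ℚ._* _) (sym (ρ-constant O∈))) (sym (π≡ρ*#cov O∈))) ⟩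
            sumL π AO                          ≡⟨ proj₁ (proj₂ π-stationary) ⟩
            1ℚ                                 ∎

      stationary-unique : ∀ O → O ∈ AO → π O ≡ c ℚ.* covSize cov O
      stationary-unique O O∈ = trans (π≡ρ*#cov O∈) (cong (ℚ._* ι (#cov O)) (trans (ρ-constant O∈) M≡c))

    stationaryCR : StationaryCR AO cov
    stationaryCR = c , c-pos , π-CR-stationary , stationary-unique

theorem5p10 : (n : ℕ) (G : Graph n) → HasEdge G →
    (AO : List (Ori n)) → Unique AO → (∀ O → (O ∈ AO) ⇔ Acyclic G O) →
    (cov : Ori n → List (Fin n × Fin n)) →
    (∀ O → Acyclic G O → Unique (cov O) × (∀ e → (e ∈ cov O) ⇔ Cover O e)) →
    CRisSRW G × SkelSimple G × SkelConnected G × SkelBipartite G ×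
    (∀ O → Acyclic G O → IsPeriod O 2) × StationaryCR AO cov
theorem5p10 n G he AO AO-unique AO-spec cov cov-spec =
  CR-isSRW G , skeleton-simple G , skeleton-connected G , skeleton-bipartite G , period-two G he ,
  Stationary.stationaryCR G he AO AO-unique AO-spec cov cov-spec
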